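{- Let $L$ be an $n\times n$ matrix with non-negative integer entries and zero diagonal. Then: (i) if $L$ is irreducible, $\mathcal{D}(L)=\{\mathbf{d}\in\min\mathcal{D}_{\ge 0}(L) \mid \det(\mathrm{Diag}(\mathbf{d})-L)=0\}$ (in particular $\mathcal{D}(L)$ is finite and obtained from the finite set $\min\mathcal{D}_{\ge0}(L)$); (ii) if $L$ is not irreducible and has a row with all entries equal to zero, then $\mathcal{A}(L)=\emptyset$; (iii) if $L$ is not irreducible and has no zero row, then $\mathcal{A}(L)$ is infinite.
   Context: $\mathbb{N}_+$ denotes the positive integers. $\mathcal{A}(L)=\{(\mathbf{d},\mathbf{r})\in\mathbb{N}_+^n\times\mathbb{N}_+^n \mid (\mathrm{Diag}(\mathbf{d})-L)\mathbf{r}^t=\mathbf{0}^t,\ \gcd(r_1,\ldots,r_n)=1\}$ is the set of arithmetical structures of $L$ and $\mathcal{D}(L)=\{\mathbf{d} \mid (\mathbf{d},\mathbf{r})\in\mathcal{A}(L)\text{ for some }\mathbf{r}\}$. A matrix $A$ is reducible if there is a permutation matrix $P$ with $P^tAP=\begin{pmatrix}X&Y\\0&Z\end{pmatrix}$ (square diagonal blocks $X,Z$ of positive size), and irreducible otherwise. A real square Z-matrix (off-diagonal entries $\le0$) is an almost non-singular $M$-matrix if all its proper principal minors are positive and its determinant is non-negative. $\mathcal{D}_{\ge 0}(L)=\{\mathbf{d}\in\mathbb{N}_+^n \mid \mathrm{Diag}(\mathbf{d})-L \text{ is an almost non-singular } M\text{ -matrix}\}$, and $\min$ denotes the set of minimal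 elements under the componentwise partial order. -}

module Defs where

open import Data.Nat as ℕ using (ℕ; zero; suc)
open import Data.Nat.GCD using (gcd)
open import Data.Integer as ℤ using (ℤ; +_; -_)
open import Data.Fin using (Fin; zero; suc; toℕ; punchIn; _≟_)
open import Data.Fin.Permutation using (Permutation′; _⟨$⟩ʳ_)
open import Data.Vec using (Vec; lookup; foldr)
open import Data.List using (List)
open import Data.List.Membership.Propositional using (_∉_)
open import Data.Product using (Σ; ∃; _×_; _,_)
open import Relation.Nullary using (¬_; yes; no)
open import Relation.Binary.PropositionalEquality using (_≡_)

Matrix : Set → ℕ → Set
Matrix A n = Fin n → Fin n → A

∑ : ∀ {n} → (Fin n → ℤ) → ℤ
∑ {zero}  f = + 0
∑ {suc n} f = f zero ℤ.+ ∑ (λ i → f (suc i))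

sign : ℕ → ℤ
sign zero    = + 1
sign (suc k) = - sign k

det : ∀ {n} → Matrix ℤ n → ℤ
det {zero}  M = + 1
det {suc n} M =
  ∑ (λ j → sign (toℕ j) ℤ.* (M zero j ℤ.* det (λ i k → M (suc i) (punchIn j k))))

DiagMinus : ∀ {n} → Vec ℕ n → Matrix ℕ n → Matrix ℤ n
DiagMinus d L i j with i ≟ j
... | yes _ = + lookup d i ℤ.- + L i j
... | no  _ = - (+ L i j)

mulVec : ∀ {n} → Matrix ℤ n → Vec ℕ n → Fin n → ℤ
mulVec M r i = ∑ (λ j → M i j ℤ.* + lookup r j)

-- gcd of the entries of a vector (gcd of the empty vector is 0)
gcdVec : ∀ {n} → Vec ℕ n → ℕ
gcdVec = foldr _ gcd 0

Positive : ∀ {n} → Vec ℕ n → Set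
Positive v = ∀ i → 0 ℕ.< lookup v i

_≤ᵥ_ : ∀ {n} → Vec ℕ n → Vec ℕ n → Set
d ≤ᵥ d' = ∀ i → lookup d i ℕ.≤ lookup d' i

ArithStruct : ∀ {n} → Matrix ℕ n → Vec ℕ n × Vec ℕ n → Set
ArithStruct L (d , r) =
  Positive d × Positive r × (∀ i → mulVec (DiagMinus d L) r i ≡ + 0) × gcdVec r ≡ 1

DSet : ∀ {n} → Matrix ℕ n → Vec ℕ n → Set
DSet L d = ∃ λ r → ArithStruct L (d , r)

Reducible : ∀ {n} → Matrix ℕ n → Set
Reducible {n} A =
  Σ (Permutation′ n) λ π → Σ ℕ λ k → 0 ℕ.< k × k ℕ.< n ×
    (∀ i j → k ℕ.≤ toℕ i → toℕ j ℕ.< k → A (π ⟨$⟩ʳ i) (π ⟨$⟩ʳ j) ≡ 0)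

Irreducible : ∀ {n} → Matrix ℕ n → Set
Irreducible A = ¬ Reducible A

ZMatrix : ∀ {n} → Matrix ℤ n → Set
ZMatrix M = ∀ i j → ¬ i ≡ j → M i j ℤ.≤ + 0

-- strictly increasing maps Fin k → Fin n (index sets of principal submatrices)
StrictlyIncreasing : ∀ {k n} → (Fin k → Fin n) → Set
StrictlyIncreasing σ = ∀ i j → toℕ i ℕ.< toℕ j → toℕ (σ i) ℕ.< toℕ (σ j)

principalMinor : ∀ {k n} → Matrix ℤ n → (Fin k → Fin n) → ℤ
principalMinor M σ = det (λ i j → M (σ i) (σ j))

AlmostNonSingularM : ∀ {n} → Matrix ℤ n → Set
AlmostNonSingularM {n} M =
  ZMatrix M ×
  (∀ k (σ : Fin k → Fin n) → k ℕ.< n → StrictlyIncreasing σ →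
     ℤ.+ 0 ℤ.< principalMinor M σ) ×
  (+ 0 ℤ.≤ det M)

DGe0 : ∀ {n} → Matrix ℕ n → Vec ℕ n → Set
DGe0 L d = Positive d × AlmostNonSingularM (DiagMinus d L)

Minimal : ∀ {n} → (Vec ℕ n → Set) → Vec ℕ n → Set
Minimal P d = P d × (∀ d' → P d' → d' ≤ᵥ d → d' ≡ d)

Infinite : {X : Set} → (X → Set) → Set
Infinite {X} P = ∀ (xs : List X) → ∃ λ x → P x × x ∉ xs

ZeroDiag : ∀ {n} → Matrix ℕ n → Set
ZeroDiag L = ∀ i → L i i ≡ 0

HasZeroRow : ∀ {n} → Matrix ℕ n → Set
HasZeroRow L = ∃ λ i → ∀ j → L i j ≡ 0

module Submission where

-- Everything rests on Chiò's condensation: for a pivot a = M₀₀ > 0 the matrix a·(Schur complement of a)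
-- has determinant a^(n−1) det M, stays a Z-matrix, keeps the proper principal minors positive and turns
-- kernel vectors of M into kernel vectors of itself (and back, after rescaling); the matrix facts are
-- proved by induction on the size through it. For M = Diag(d) − L and irreducible L: a positive kernel
-- vector r makes det M = 0, and since no proper set of indices is closed under M it makes all proper
-- principal minors positive; d is minimal because for d′ ≤ d in D≥0(L) the vector (Diag(d′) − L) r =
-- (d′ − d) r ≤ 0 must vanish. Conversely a singular almost non-singular M-matrix has a positive kernel
-- vector, which divided by its gcd gives r. A zero row i forces dᵢ rᵢ = 0. If L is reducible, some
-- proper set S of indices is closed; r = t on S and 1 elsewhere gives an integral d = (L r) / r for
-- every t > 0.

open import Data.Bool using (Bool; true; false)
import Data.Bool as Bool
import Data.Bool.Properties as BoolP
open import Data.Empty using (⊥-elim)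
open import Data.Fin using (Fin; zero; suc; toℕ; punchIn; punchOut; inject₁; fromℕ<; lift)
open import Data.Fin.Permutation using (Permutation′; _⟨$⟩ʳ_; _⟨$⟩ˡ_; insert; inverseʳ; inverseˡ; insert-punchIn)
import Data.Fin.Permutation as Perm
import Data.Fin.Properties as FinP
open import Data.Fin.Subset.Properties using (anySubset?)
open import Data.Integer as ℤ using (ℤ; +_; -_; _+_; _*_; _-_; _^_; +[1+_]; -[1+_]; +≤+; +<+)
import Data.Integer.Properties as ℤP
open import Data.Integer.Tactic.RingSolver using (solve-∀)
open import Data.List using (List; []; _∷_)
open import Data.List.Membership.Propositional using (_∈_; _∉_)
open import Data.List.Relation.Unary.Any using (here; there)
open import Data.Nat as ℕ using (ℕ; zero; suc; z≤n; s≤s)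
open import Data.Nat.Divisibility using (_∣_; ∣-trans; _∣0; ∣1⇒≡1; *-monoˡ-∣; *-cancelʳ-∣)
open import Data.Nat.GCD using (gcd-greatest; gcd[m,n]∣m; gcd[m,n]∣n)
import Data.Nat.Properties as ℕP
open import Data.Product using (Σ; ∃-syntax; _×_; _,_; proj₁; proj₂)
open import Data.Sum using (_⊎_; inj₁; inj₂)
open import Data.Vec using (Vec; _∷_; []; lookup; replicate; tabulate)
import Data.Vec.Properties as VecP
open import Function using (_∘_)
open import Function.Bundles using (_⇔_; mk⇔)
open import Relation.Binary.Definitions using (tri<; tri≈; tri>)
open import Relation.Binary.PropositionalEquality
open import Relation.Nullary using (¬_; Dec; yes; no; does)
open import Relation.Nullary.Decidable using (_×-dec_; _→-dec_; ¬?; decidable-stable; dec-true; dec-false)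

open import Defs

open import Algebra.Properties.CommutativeSemigroup ℤP.+-commutativeSemigroup using (interchange)
open import Algebra.Properties.Semiring.Sum ℕP.+-*-semiring using (sum; sum-cong-≗; *-distribʳ-sum)

private
  variable
    n k : ℕ

∑-cong : {f g : Fin n → ℤ} → (∀ i → f i ≡ g i) → ∑ f ≡ ∑ g
∑-cong {zero}  eq = refl
∑-cong {suc n} eq = cong₂ _+_ (eq zero) (∑-cong (eq ∘ suc))

∑-distrib-+ : (f g : Fin n → ℤ) → ∑ (λ i → f i + g i) ≡ ∑ f + ∑ g
∑-distrib-+ {zero}  f g = refl
∑-distrib-+ {suc n} f g =
  trans (cong (_+_ (f zero + g zero)) (∑-distrib-+ (f ∘ suc) (g ∘ suc)))
        (interchange (f zero) (g zero) (∑ (f ∘ suc)) (∑ (g ∘ suc)))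

*-distribˡ-∑ : (c : ℤ) (f : Fin n → ℤ) → c * ∑ f ≡ ∑ (λ i → c * f i)
*-distribˡ-∑ {zero}  c f = ℤP.*-zeroʳ c
*-distribˡ-∑ {suc n} c f =
  trans (ℤP.*-distribˡ-+ c (f zero) _) (cong (_+_ (c * f zero)) (*-distribˡ-∑ c (f ∘ suc)))

neg-distrib-∑ : (f : Fin n → ℤ) → - ∑ f ≡ ∑ (λ i → - f i)
neg-distrib-∑ {zero}  f = refl
neg-distrib-∑ {suc n} f =
  trans (ℤP.neg-distrib-+ (f zero) _) (cong (_+_ (- f zero)) (neg-distrib-∑ (f ∘ suc)))

∑-zero : (f : Fin n → ℤ) → (∀ i → f i ≡ + 0) → ∑ f ≡ + 0
∑-zero {zero}  f eq = refl
∑-zero {suc n} f eq = cong₂ _+_ (eq zero) (∑-zero (f ∘ suc) (eq ∘ suc))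

∑-single : (f : Fin n → ℤ) (i : Fin n) → (∀ j → j ≢ i → f j ≡ + 0) → ∑ f ≡ f i
∑-single {suc n} f zero    eq =
  trans (cong (_+_ (f zero)) (∑-zero (f ∘ suc) (λ j → eq (suc j) λ ()))) (ℤP.+-identityʳ _)
∑-single {suc n} f (suc i) eq =
  trans (cong (_+ ∑ (f ∘ suc)) (eq zero λ ()))
        (trans (ℤP.+-identityˡ _) (∑-single (f ∘ suc) i (λ j j≢i → eq (suc j) (j≢i ∘ FinP.suc-injective))))

nonNeg*nonNeg : {a b : ℤ} → + 0 ℤ.≤ a → + 0 ℤ.≤ b → + 0 ℤ.≤ a * b
nonNeg*nonNeg {a} 0≤a 0≤b =
  ℤP.≤-trans (ℤP.≤-reflexive (sym (ℤP.*-zeroʳ a))) (ℤP.*-monoˡ-≤-nonNeg a {{ℤ.nonNegative 0≤a}} 0≤b)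

nonNeg*nonPos : {a b : ℤ} → + 0 ℤ.≤ a → b ℤ.≤ + 0 → a * b ℤ.≤ + 0
nonNeg*nonPos {a} 0≤a b≤0 =
  ℤP.≤-trans (ℤP.*-monoˡ-≤-nonNeg a {{ℤ.nonNegative 0≤a}} b≤0) (ℤP.≤-reflexive (ℤP.*-zeroʳ a))

nonPos*nonNeg : {a b : ℤ} → a ℤ.≤ + 0 → + 0 ℤ.≤ b → a * b ℤ.≤ + 0
nonPos*nonNeg {a} {b} a≤0 0≤b = ℤP.≤-trans (ℤP.≤-reflexive (ℤP.*-comm a b)) (nonNeg*nonPos 0≤b a≤0)

nonPos*nonPos : {a b : ℤ} → a ℤ.≤ + 0 → b ℤ.≤ + 0 → + 0 ℤ.≤ a * b
nonPos*nonPos {a} a≤0 b≤0 =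
  ℤP.≤-trans (ℤP.≤-reflexive (sym (ℤP.*-zeroʳ a))) (ℤP.*-monoˡ-≤-nonPos a {{ℤ.nonPositive a≤0}} b≤0)

pos*pos : {a b : ℤ} → + 0 ℤ.< a → + 0 ℤ.< b → + 0 ℤ.< a * b
pos*pos {a} 0<a 0<b =
  ℤP.≤-<-trans (ℤP.≤-reflexive (sym (ℤP.*-zeroʳ a))) (ℤP.*-monoˡ-<-pos a {{ℤ.positive 0<a}} 0<b)

pos*neg : {a b : ℤ} → + 0 ℤ.< a → b ℤ.< + 0 → a * b ℤ.< + 0
pos*neg {a} 0<a b<0 =
  ℤP.<-≤-trans (ℤP.*-monoˡ-<-pos a {{ℤ.positive 0<a}} b<0) (ℤP.≤-reflexive (ℤP.*-zeroʳ a))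

neg*neg : {a b : ℤ} → a ℤ.< + 0 → b ℤ.< + 0 → + 0 ℤ.< a * b
neg*neg {a} a<0 b<0 =
  ℤP.≤-<-trans (ℤP.≤-reflexive (sym (ℤP.*-zeroʳ a))) (ℤP.*-monoˡ-<-neg a {{ℤ.negative a<0}} b<0)

^-pos : {a : ℤ} → + 0 ℤ.< a → ∀ m → + 0 ℤ.< a ^ m
^-pos 0<a zero    = +<+ (s≤s z≤n)
^-pos 0<a (suc m) = pos*pos 0<a (^-pos 0<a m)

*-cancelˡ-nonNeg : {a b : ℤ} → + 0 ℤ.< a → + 0 ℤ.≤ a * b → + 0 ℤ.≤ b
*-cancelˡ-nonNeg {a} {b} 0<a 0≤ab =
  ℤP.*-cancelˡ-≤-pos (+ 0) b a {{ℤ.positive 0<a}} (ℤP.≤-trans (ℤP.≤-reflexive (ℤP.*-zeroʳ a)) 0≤ab)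

*-cancelˡ-pos : {a b : ℤ} → + 0 ℤ.≤ a → + 0 ℤ.< a * b → + 0 ℤ.< b
*-cancelˡ-pos {a} 0≤a 0<ab =
  ℤP.*-cancelˡ-<-nonNeg a {{ℤ.nonNegative 0≤a}} (ℤP.≤-<-trans (ℤP.≤-reflexive (ℤP.*-zeroʳ a)) 0<ab)

*-cancelˡ-≡0 : {a b : ℤ} → a ≢ + 0 → a * b ≡ + 0 → b ≡ + 0
*-cancelˡ-≡0 {a} a≢0 ab≡0 with ℤP.i*j≡0⇒i≡0∨j≡0 a ab≡0
... | inj₁ a≡0 = ⊥-elim (a≢0 a≡0)
... | inj₂ b≡0 = b≡0

pos⇒≢0 : {a : ℤ} → + 0 ℤ.< a → a ≢ + 0
pos⇒≢0 0<a = ℤP.<⇒≢ 0<a ∘ sym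

nonNeg+nonNeg≡0 : {a b : ℤ} → + 0 ℤ.≤ a → + 0 ℤ.≤ b → a + b ≡ + 0 → a ≡ + 0 × b ≡ + 0
nonNeg+nonNeg≡0 {+ m} {+ k} _ _ eq =
  cong +_ (ℕP.m+n≡0⇒m≡0 m (ℤP.+-injective eq)) , cong +_ (ℕP.m+n≡0⇒n≡0 m (ℤP.+-injective eq))

nonPos+nonPos≡0 : {a b : ℤ} → a ℤ.≤ + 0 → b ℤ.≤ + 0 → a + b ≡ + 0 → a ≡ + 0 × b ≡ + 0
nonPos+nonPos≡0 {a} {b} a≤0 b≤0 eq
  with nonNeg+nonNeg≡0 (ℤP.neg-mono-≤ a≤0) (ℤP.neg-mono-≤ b≤0) (trans (sym (ℤP.neg-distrib-+ a b)) (cong -_ eq))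
... | -a≡0 , -b≡0 = ℤP.neg-injective -a≡0 , ℤP.neg-injective -b≡0

nonNeg-nonPos≡0 : {u v : ℤ} → + 0 ℤ.≤ u → v ℤ.≤ + 0 → u - v ≡ + 0 → u ≡ + 0 × v ≡ + 0
nonNeg-nonPos≡0 0≤u v≤0 u-v≡0 with nonNeg+nonNeg≡0 0≤u (ℤP.neg-mono-≤ v≤0) u-v≡0
... | u≡0 , -v≡0 = u≡0 , ℤP.neg-injective -v≡0

nonPos-nonNeg≡0 : {u v : ℤ} → u ℤ.≤ + 0 → + 0 ℤ.≤ v → u - v ≡ + 0 → u ≡ + 0 × v ≡ + 0
nonPos-nonNeg≡0 u≤0 0≤v u-v≡0 with nonPos+nonPos≡0 u≤0 (ℤP.neg-mono-≤ 0≤v) u-v≡0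
... | u≡0 , -v≡0 = u≡0 , ℤP.neg-injective -v≡0

∑-nonPos : (f : Fin n → ℤ) → (∀ i → f i ℤ.≤ + 0) → ∑ f ℤ.≤ + 0
∑-nonPos {zero}  f f≤0 = +≤+ z≤n
∑-nonPos {suc n} f f≤0 = ℤP.+-mono-≤ (f≤0 zero) (∑-nonPos (f ∘ suc) (f≤0 ∘ suc))

∑-nonPos-≡0 : (f : Fin n → ℤ) → (∀ i → f i ℤ.≤ + 0) → ∑ f ≡ + 0 → ∀ i → f i ≡ + 0
∑-nonPos-≡0 {suc n} f f≤0 ∑≡0 i
  with nonPos+nonPos≡0 (f≤0 zero) (∑-nonPos (f ∘ suc) (f≤0 ∘ suc)) ∑≡0
∑-nonPos-≡0 {suc n} f f≤0 ∑≡0 zero    | f0≡0 , _    = f0≡0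
∑-nonPos-≡0 {suc n} f f≤0 ∑≡0 (suc i) | _    , rest = ∑-nonPos-≡0 (f ∘ suc) (f≤0 ∘ suc) rest i

∑-nonPos-neg : (f : Fin n → ℤ) → (∀ i → f i ℤ.≤ + 0) → ∀ i → f i ℤ.< + 0 → ∑ f ℤ.< + 0
∑-nonPos-neg {suc n} f f≤0 zero    fi<0 = ℤP.+-mono-<-≤ fi<0 (∑-nonPos (f ∘ suc) (f≤0 ∘ suc))
∑-nonPos-neg {suc n} f f≤0 (suc i) fi<0 = ℤP.+-mono-≤-< (f≤0 zero) (∑-nonPos-neg (f ∘ suc) (f≤0 ∘ suc) i fi<0)

-- Determinants

minor : Matrix ℤ (suc n) → Fin (suc n) → Matrix ℤ n
minor A j i k = A (suc i) (punchIn j k)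

det-cong : {A B : Matrix ℤ n} → (∀ i j → A i j ≡ B i j) → det A ≡ det B
det-cong {zero}  A≡B = refl
det-cong {suc n} A≡B = ∑-cong λ j →
  cong₂ (λ u v → sign (toℕ j) * (u * v)) (A≡B zero j) (det-cong λ i k → A≡B (suc i) (punchIn j k))

laplaceTerm : Matrix ℤ (suc n) → Fin (suc n) → ℤ
laplaceTerm M j = sign (toℕ j) * (M zero j * det (minor M j))

laplaceTerm-zeroEntry : (M : Matrix ℤ (suc n)) (j : Fin (suc n)) → M zero j ≡ + 0 → laplaceTerm M j ≡ + 0
laplaceTerm-zeroEntry M j M₀ⱼ≡0 =
  trans (cong (λ v → sign (toℕ j) * (v * det (minor M j))) M₀ⱼ≡0) (vanish (sign (toℕ j)) (det (minor M j)))
  where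
  vanish : ∀ (s d : ℤ) → s * (+ 0 * d) ≡ + 0
  vanish = solve-∀

det₁ : (A : Matrix ℤ 1) → det A ≡ A zero zero
det₁ A = trans (ℤP.+-identityʳ _) (trans (ℤP.*-identityˡ _) (ℤP.*-identityʳ _))

det-zeroRow₀ : (A : Matrix ℤ (suc n)) → (∀ j → A zero j ≡ + 0) → det A ≡ + 0
det-zeroRow₀ A row≡0 = ∑-zero (laplaceTerm A) λ j → laplaceTerm-zeroEntry A j (row≡0 j)

det-linear-column : (A B C : Matrix ℤ n) (c : Fin n) (x y : ℤ) →
  (∀ i j → j ≢ c → A i j ≡ C i j) → (∀ i j → j ≢ c → B i j ≡ C i j) →
  (∀ i → C i c ≡ x * A i c + y * B i c) → det C ≡ x * det A + y * det B
det-linear-column {suc n} A B C c x y A≈C B≈C Cc = begin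
  ∑ (laplaceTerm C)                                          ≡⟨ ∑-cong term ⟩
  ∑ (λ j → x * T A j + y * T B j)                            ≡⟨ ∑-distrib-+ (λ j → x * T A j) (λ j → y * T B j) ⟩
  ∑ (λ j → x * T A j) + ∑ (λ j → y * T B j)
    ≡⟨ sym (cong₂ _+_ (*-distribˡ-∑ x (T A)) (*-distribˡ-∑ y (T B))) ⟩
  x * det A + y * det B                                      ∎
  where
  open ≡-Reasoning
  T = laplaceTerm
  sameMinor : (M : Matrix ℤ (suc n)) → (∀ i j → j ≢ c → M i j ≡ C i j) → det (minor M c) ≡ det (minor C c)
  sameMinor M M≈C = det-cong λ i k → M≈C (suc i) (punchIn c k) (FinP.punchInᵢ≢i c k)
  term : ∀ j → T C j ≡ x * T A j + y * T B j
  term j with j FinP.≟ c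
  ... | yes refl = begin
    s * (C zero j * det (minor C j))
      ≡⟨ cong₂ (λ u v → s * (u * v)) (Cc zero) (sym (sameMinor A A≈C)) ⟩
    s * ((x * A zero j + y * B zero j) * det (minor A j))
      ≡⟨ expand s (A zero j) (B zero j) (det (minor A j)) x y ⟩
    x * T A j + y * (s * (B zero j * det (minor A j)))
      ≡⟨ cong (λ v → x * T A j + y * (s * (B zero j * v))) (trans (sameMinor A A≈C) (sym (sameMinor B B≈C))) ⟩
    x * T A j + y * T B j ∎
    where
    open ≡-Reasoning
    s = sign (toℕ j)
    expand : ∀ (s a b d x y : ℤ) → s * ((x * a + y * b) * d) ≡ x * (s * (a * d)) + y * (s * (b * d))
    expand = solve-∀
  ... | no j≢c = begin
    s * (C zero j * det (minor C j))
      ≡⟨ cong₂ (λ u v → s * (u * v)) (sym (A≈C zero j j≢c)) ih ⟩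
    s * (A zero j * (x * det (minor A j) + y * det (minor B j)))
      ≡⟨ expand s (A zero j) (det (minor A j)) (det (minor B j)) x y ⟩
    x * T A j + y * (s * (A zero j * det (minor B j)))
      ≡⟨ cong (λ u → x * T A j + y * (s * (u * det (minor B j)))) (trans (A≈C zero j j≢c) (sym (B≈C zero j j≢c))) ⟩
    x * T A j + y * T B j ∎
    where
    open ≡-Reasoning
    s = sign (toℕ j)
    expand : ∀ (s a da db x y : ℤ) → s * (a * (x * da + y * db)) ≡ x * (s * (a * da)) + y * (s * (a * db))
    expand = solve-∀
    c′ : Fin n
    c′ = punchOut j≢c
    punchIn-c′ : punchIn j c′ ≡ c
    punchIn-c′ = FinP.punchIn-punchOut j≢c
    off-c′ : ∀ {k} → k ≢ c′ → punchIn j k ≢ c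
    off-c′ k≢c′ eq = k≢c′ (FinP.punchIn-injective j _ _ (trans eq (sym punchIn-c′)))
    ih : det (minor C j) ≡ x * det (minor A j) + y * det (minor B j)
    ih = det-linear-column (minor A j) (minor B j) (minor C j) c′ x y
      (λ i k k≢c′ → A≈C (suc i) (punchIn j k) (off-c′ k≢c′))
      (λ i k k≢c′ → B≈C (suc i) (punchIn j k) (off-c′ k≢c′))
      (λ i → trans (cong (C (suc i)) punchIn-c′)
               (trans (Cc (suc i)) (sym (cong₂ (λ u v → x * A (suc i) u + y * B (suc i) v) punchIn-c′ punchIn-c′))))

swapNext : Fin (suc n) → Fin (suc (suc n)) → Fin (suc (suc n))
swapNext         zero    zero          = suc zero
swapNext         zero    (suc zero)    = zero
swapNext         zero    (suc (suc k)) = suc (suc k)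
swapNext {suc n} (suc c) zero          = zero
swapNext {suc n} (suc c) (suc k)       = suc (swapNext c k)

swapNext-involutive : (c : Fin (suc n)) (j : Fin (suc (suc n))) → swapNext c (swapNext c j) ≡ j
swapNext-involutive         zero    zero          = refl
swapNext-involutive         zero    (suc zero)    = refl
swapNext-involutive         zero    (suc (suc j)) = refl
swapNext-involutive {suc n} (suc c) zero          = refl
swapNext-involutive {suc n} (suc c) (suc j)       = cong suc (swapNext-involutive c j)

swapNext-inject₁ : (c : Fin (suc n)) → swapNext c (inject₁ c) ≡ suc c
swapNext-inject₁         zero    = refl
swapNext-inject₁ {suc n} (suc c) = cong suc (swapNext-inject₁ c)

∑-swapNext : (c : Fin (suc n)) (f : Fin (suc (suc n)) → ℤ) → ∑ f ≡ ∑ (f ∘ swapNext c)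
∑-swapNext zero f = exchange (f zero) (f (suc zero)) (∑ (λ i → f (suc (suc i))))
  where
  exchange : ∀ (a b r : ℤ) → a + (b + r) ≡ b + (a + r)
  exchange = solve-∀
∑-swapNext {suc n} (suc c) f = cong (_+_ (f zero)) (∑-swapNext c (f ∘ suc))

-- For the column j of a Laplace expansion along row 0, swapping columns c and c + 1 either exchanges
-- j with its neighbour (the sign flips, the minor is unchanged) or fixes j (the minor gets the
-- corresponding swap).
SwapMoves : Fin (suc n) → Fin (suc (suc n)) → Set
SwapMoves c j = sign (toℕ (swapNext c j)) ≡ - sign (toℕ j)
              × (∀ k → swapNext c (punchIn (swapNext c j) k) ≡ punchIn j k)

SwapFixes : Fin (suc (suc n)) → Fin (suc (suc (suc n))) → Set
SwapFixes {n} c j = toℕ (swapNext c j) ≡ toℕ j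
                  × Σ (Fin (suc n)) λ c′ → ∀ k → swapNext c (punchIn (swapNext c j) k) ≡ punchIn j (swapNext c′ k)

swapMoves-suc : (c : Fin (suc n)) (j : Fin (suc (suc n))) → SwapMoves c j → SwapMoves (suc c) (suc j)
swapMoves-suc c j (flips , minors) = cong -_ flips , λ { zero → refl ; (suc k) → cong suc (minors k) }

swapNext₂-moves : (c : Fin 1) (j : Fin 2) → SwapMoves c j
swapNext₂-moves zero zero       = refl , λ { zero → refl }
swapNext₂-moves zero (suc zero) = refl , λ { zero → refl }

swapNext-cases : (c : Fin (suc (suc n))) (j : Fin (suc (suc (suc n)))) → SwapMoves c j ⊎ SwapFixes c j
swapNext-cases zero zero                = inj₁ (refl , λ { zero → refl ; (suc k) → refl })
swapNext-cases zero (suc zero)          = inj₁ (refl , λ { zero → refl ; (suc k) → refl })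
swapNext-cases zero (suc (suc j))       = inj₂ (refl , zero , λ { zero → refl ; (suc zero) → refl ; (suc (suc k)) → refl })
swapNext-cases (suc c) zero             = inj₂ (refl , c , λ k → refl)
swapNext-cases {zero} (suc c) (suc j)   = inj₁ (swapMoves-suc c j (swapNext₂-moves c j))
swapNext-cases {suc n} (suc c) (suc j) with swapNext-cases c j
... | inj₁ moves                = inj₁ (swapMoves-suc c j moves)
... | inj₂ (fixes , c′ , minors) = inj₂ (cong suc fixes , suc c′ , λ { zero → refl ; (suc k) → cong suc (minors k) })

det-swapNext : (A : Matrix ℤ (suc (suc n))) (c : Fin (suc n)) → det (λ i j → A i (swapNext c j)) ≡ - det A
det-swapNext {n} A c =
  trans (∑-swapNext c (T (λ i j → A i (swapNext c j)))) (trans (∑-cong (term n A c)) (sym (neg-distrib-∑ (T A))))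
  where
  T = laplaceTerm
  swappedMinor : ∀ {n} (A : Matrix ℤ (suc (suc n))) c j → Matrix ℤ (suc n)
  swappedMinor A c j i k = A (suc i) (swapNext c (punchIn (swapNext c j) k))
  moved : ∀ {n} (A : Matrix ℤ (suc (suc n))) c j → SwapMoves c j →
    T (λ i j → A i (swapNext c j)) (swapNext c j) ≡ - T A j
  moved A c j (flips , minors) = begin
    sign (toℕ (swapNext c j)) * (A zero (swapNext c (swapNext c j)) * det (swappedMinor A c j))
      ≡⟨ cong₂ (λ u v → u * (A zero v * det (swappedMinor A c j))) flips (swapNext-involutive c j) ⟩
    - sign (toℕ j) * (A zero j * det (swappedMinor A c j))
      ≡⟨ cong (λ v → - sign (toℕ j) * (A zero j * v)) (det-cong λ i k → cong (A (suc i)) (minors k)) ⟩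
    - sign (toℕ j) * (A zero j * det (minor A j))
      ≡⟨ sym (ℤP.neg-distribˡ-* (sign (toℕ j)) _) ⟩
    - T A j ∎
    where open ≡-Reasoning
  term : ∀ n (A : Matrix ℤ (suc (suc n))) c j → T (λ i j → A i (swapNext c j)) (swapNext c j) ≡ - T A j
  term zero    A c j = moved A c j (swapNext₂-moves c j)
  term (suc m) A c j with swapNext-cases c j
  ... | inj₁ moves                = moved A c j moves
  ... | inj₂ (fixes , c′ , minors) = begin
    sign (toℕ (swapNext c j)) * (A zero (swapNext c (swapNext c j)) * det (swappedMinor A c j))
      ≡⟨ cong₂ (λ u v → sign u * (A zero v * det (swappedMinor A c j))) fixes (swapNext-involutive c j) ⟩
    sign (toℕ j) * (A zero j * det (swappedMinor A c j))
      ≡⟨ cong (λ v → sign (toℕ j) * (A zero j * v))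
           (trans (det-cong λ i k → cong (A (suc i)) (minors k)) (det-swapNext (minor A j) c′)) ⟩
    sign (toℕ j) * (A zero j * - det (minor A j))
      ≡⟨ pull-neg (sign (toℕ j)) (A zero j) (det (minor A j)) ⟩
    - T A j ∎
    where
    open ≡-Reasoning
    pull-neg : ∀ (s a d : ℤ) → s * (a * - d) ≡ - (s * (a * d))
    pull-neg = solve-∀

x≡-x⇒x≡0 : {x : ℤ} → x ≡ - x → x ≡ + 0
x≡-x⇒x≡0 {+ zero}   _  = refl
x≡-x⇒x≡0 {+[1+ m ]} ()
x≡-x⇒x≡0 { -[1+ m ]} ()

det-equalColumns₀ : (A : Matrix ℤ (suc (suc n))) (c : Fin (suc n)) → (∀ i → A i zero ≡ A i (suc c)) → det A ≡ + 0
det-equalColumns₀ A c = go (toℕ c) A c refl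
  where
  -- each adjacent swap moves the copy of column 0 one step to the left
  go : ∀ {n} t (A : Matrix ℤ (suc (suc n))) (c : Fin (suc n)) → toℕ c ≡ t → (∀ i → A i zero ≡ A i (suc c)) → det A ≡ + 0
  go _ A zero _ cols = x≡-x⇒x≡0 (trans (det-cong swapped) (det-swapNext A zero))
    where
    swapped : ∀ i j → A i j ≡ A i (swapNext zero j)
    swapped i zero          = cols i
    swapped i (suc zero)    = sym (cols i)
    swapped i (suc (suc j)) = refl
  go {suc n} (suc t) A (suc c) c≡t cols =
    trans (sym (ℤP.neg-involutive (det A))) (cong -_ (trans (sym (det-swapNext A (suc c)))
      (go t (λ i j → A i (swapNext (suc c) j)) (inject₁ c) (trans (FinP.toℕ-inject₁ c) (ℕP.suc-injective c≡t))
        (λ i → trans (cols i) (cong (A i) (sym (swapNext-inject₁ (suc c))))))))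

det-addColumn₀ : (A C : Matrix ℤ (suc (suc n))) (c : Fin (suc n)) (x y : ℤ) →
  (∀ i j → j ≢ suc c → C i j ≡ A i j) → (∀ i → C i (suc c) ≡ x * A i (suc c) + y * A i zero) →
  det C ≡ x * det A
det-addColumn₀ {n} A C c x y C≈A Cc = begin
  det C                ≡⟨ det-linear-column A B C (suc c) x y (λ i j j≢ → sym (C≈A i j j≢)) B≈C
                            (λ i → trans (Cc i) (cong (λ v → x * A i (suc c) + y * v) (sym (Bc i)))) ⟩
  x * det A + y * det B ≡⟨ cong (λ v → x * det A + y * v) (det-equalColumns₀ B c (sym ∘ Bc)) ⟩
  x * det A + y * + 0  ≡⟨ cong (_+_ (x * det A)) (ℤP.*-zeroʳ y) ⟩
  x * det A + + 0      ≡⟨ ℤP.+-identityʳ _ ⟩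
  x * det A            ∎
  where
  open ≡-Reasoning
  B : Matrix ℤ (suc (suc n))
  B i j with j FinP.≟ suc c
  ... | yes _ = A i zero
  ... | no  _ = A i j
  Bc : ∀ i → B i (suc c) ≡ A i zero
  Bc i with suc c FinP.≟ suc c
  ... | yes _   = refl
  ... | no  c≢c = ⊥-elim (c≢c refl)
  B≈C : ∀ i j → j ≢ suc c → B i j ≡ C i j
  B≈C i j j≢ with j FinP.≟ suc c
  ... | yes j≡ = ⊥-elim (j≢ j≡)
  ... | no  _  = sym (C≈A i j j≢)

-- Chiò's condensation

condenseColumns : ℤ → (Fin (suc n) → ℤ) → ℕ → Matrix ℤ (suc (suc n)) → Matrix ℤ (suc (suc n))
condenseColumns a β m A i zero = A i zero
condenseColumns a β m A i (suc j) with toℕ j ℕ.<? m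
... | yes _ = a * A i (suc j) + β j * A i zero
... | no  _ = A i (suc j)

module _ (a : ℤ) (β : Fin (suc n) → ℤ) (A : Matrix ℤ (suc (suc n))) where

  condenseColumns-< : ∀ m i j → toℕ j ℕ.< m → condenseColumns a β m A i (suc j) ≡ a * A i (suc j) + β j * A i zero
  condenseColumns-< m i j j<m with toℕ j ℕ.<? m
  ... | yes _   = refl
  ... | no  j≮m = ⊥-elim (j≮m j<m)

  condenseColumns-≥ : ∀ m i j → ¬ toℕ j ℕ.< m → condenseColumns a β m A i (suc j) ≡ A i (suc j)
  condenseColumns-≥ m i j j≮m with toℕ j ℕ.<? m
  ... | yes j<m = ⊥-elim (j≮m j<m)
  ... | no  _   = refl

  det-condenseColumns : ∀ m → m ℕ.≤ suc n → det (condenseColumns a β m A) ≡ a ^ m * det A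
  det-condenseColumns zero _ = begin
    det (condenseColumns a β 0 A) ≡⟨ det-cong untouched ⟩
    det A                         ≡⟨ sym (ℤP.*-identityˡ (det A)) ⟩
    + 1 * det A                   ∎
    where
    open ≡-Reasoning
    untouched : ∀ i j → condenseColumns a β 0 A i j ≡ A i j
    untouched i zero    = refl
    untouched i (suc j) = condenseColumns-≥ 0 i j λ ()
  det-condenseColumns (suc m) m<1+n = begin
    det (condenseColumns a β (suc m) A) ≡⟨ det-addColumn₀ (condenseColumns a β m A) _ jₘ a (β jₘ) others newColumn ⟩
    a * det (condenseColumns a β m A)   ≡⟨ cong (a *_) (det-condenseColumns m (ℕP.<⇒≤ m<1+n)) ⟩
    a * (a ^ m * det A)                 ≡⟨ sym (ℤP.*-assoc a (a ^ m) (det A)) ⟩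
    a ^ suc m * det A                   ∎
    where
    open ≡-Reasoning
    jₘ : Fin (suc n)
    jₘ = fromℕ< m<1+n
    toℕ-jₘ : toℕ jₘ ≡ m
    toℕ-jₘ = FinP.toℕ-fromℕ< m<1+n
    others : ∀ i j → j ≢ suc jₘ → condenseColumns a β (suc m) A i j ≡ condenseColumns a β m A i j
    others i zero    _ = refl
    others i (suc j) j≢ with toℕ j ℕ.<? m
    ... | yes j<m = condenseColumns-< (suc m) i j (ℕP.m<n⇒m<1+n j<m)
    ... | no  j≮m = condenseColumns-≥ (suc m) i j λ j<1+m →
      j≢ (cong suc (FinP.toℕ-injective (trans (ℕP.≤∧≮⇒≡ (ℕP.≤-pred j<1+m) j≮m) (sym toℕ-jₘ))))
    newColumn : ∀ i → condenseColumns a β (suc m) A i (suc jₘ)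
                      ≡ a * condenseColumns a β m A i (suc jₘ) + β jₘ * condenseColumns a β m A i zero
    newColumn i = trans (condenseColumns-< (suc m) i jₘ (s≤s (ℕP.≤-reflexive toℕ-jₘ)))
      (cong (λ v → a * v + β jₘ * A i zero) (sym (condenseColumns-≥ m i jₘ (ℕP.<-irrefl toℕ-jₘ))))

-- a₀₀ times the Schur complement of a₀₀.
condense : Matrix ℤ (suc n) → Matrix ℤ n
condense A i j = A zero zero * A (suc i) (suc j) - A (suc i) zero * A zero (suc j)

det-condense : (A : Matrix ℤ (suc (suc n))) → + 0 ℤ.< A zero zero → det (condense A) ≡ A zero zero ^ n * det A
det-condense {n} A 0<a = ℤP.*-cancelˡ-≡ a _ _ {{ℤ.>-nonZero 0<a}} (begin
  a * det (condense A)  ≡⟨ sym laplace ⟩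
  det C                 ≡⟨ det-cong (λ i j → sym (allColumns i j)) ⟩
  det (condenseColumns a β (suc n) A) ≡⟨ det-condenseColumns a β A (suc n) ℕP.≤-refl ⟩
  a ^ suc n * det A     ≡⟨ ℤP.*-assoc a (a ^ n) (det A) ⟩
  a * (a ^ n * det A)   ∎)
  where
  open ≡-Reasoning
  a = A zero zero
  β : Fin (suc n) → ℤ
  β j = - A zero (suc j)
  C : Matrix ℤ (suc (suc n))
  C i zero    = A i zero
  C i (suc j) = a * A i (suc j) + β j * A i zero
  allColumns : ∀ i j → condenseColumns a β (suc n) A i j ≡ C i j
  allColumns i zero    = refl
  allColumns i (suc j) = condenseColumns-< a β A (suc n) i j (FinP.toℕ<n j)
  -- column operations have cleared row 0 of C except for a, so its Laplace expansion has one term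
  laplace : det C ≡ a * det (condense A)
  laplace = trans (cong₂ _+_ first (∑-zero (laplaceTerm C ∘ suc) rest)) (ℤP.+-identityʳ _)
    where
    swap-terms : ∀ (a b c d : ℤ) → a * b + (- c) * d ≡ a * b - d * c
    swap-terms = solve-∀
    cancels : ∀ (a b : ℤ) → a * b + (- b) * a ≡ + 0
    cancels = solve-∀
    first : laplaceTerm C zero ≡ a * det (condense A)
    first = trans (ℤP.*-identityˡ _) (cong (a *_) (det-cong λ i k →
      swap-terms a (A (suc i) (suc k)) (A zero (suc k)) (A (suc i) zero)))
    rest : ∀ j → laplaceTerm C (suc j) ≡ + 0
    rest j = laplaceTerm-zeroEntry C (suc j) (cancels a (A zero (suc j)))

det-condense-≡0 : (A : Matrix ℤ (suc (suc n))) → + 0 ℤ.< A zero zero → det A ≡ + 0 → det (condense A) ≡ + 0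
det-condense-≡0 {n} A 0<a det≡0 =
  trans (det-condense A 0<a) (trans (cong (A zero zero ^ n *_) det≡0) (ℤP.*-zeroʳ (A zero zero ^ n)))

infixl 7 _*ᵥ_

_*ᵥ_ : Matrix ℤ n → (Fin n → ℕ) → Fin n → ℤ
(N *ᵥ x) i = ∑ (λ j → N i j * + x j)

AllPositive : (Fin n → ℕ) → Set
AllPositive x = ∀ i → 0 ℕ.< x i

row₀-tail : Matrix ℤ (suc n) → (Fin n → ℕ) → ℤ
row₀-tail N y = ∑ (λ j → N zero (suc j) * + y j)

nonPos*ℕ : {a : ℤ} (m : ℕ) → a ℤ.≤ + 0 → a * + m ℤ.≤ + 0
nonPos*ℕ m a≤0 = nonPos*nonNeg a≤0 (+≤+ z≤n)

row₀-tail-nonPos : (N : Matrix ℤ (suc n)) (y : Fin n → ℕ) → ZMatrix N → row₀-tail N y ℤ.≤ + 0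
row₀-tail-nonPos N y Z = ∑-nonPos _ λ j → nonPos*ℕ (y j) (Z zero (suc j) λ ())

a*m≡0⇒a≡0 : {a : ℤ} {m : ℕ} → 0 ℕ.< m → a * + m ≡ + 0 → a ≡ + 0
a*m≡0⇒a≡0 {a} {m} 0<m eq = *-cancelˡ-≡0 (pos⇒≢0 (+<+ 0<m)) (trans (ℤP.*-comm (+ m) a) eq)

module _ (N : Matrix ℤ (suc n)) (x : Fin (suc n) → ℕ) (Z : ZMatrix N) (x>0 : AllPositive x)
         (Nx₀≥0 : + 0 ℤ.≤ (N *ᵥ x) zero) where

  diag₀-nonNeg : + 0 ℤ.≤ N zero zero
  diag₀-nonNeg = *-cancelˡ-nonNeg (+<+ (x>0 zero)) (begin
    + 0                                           ≤⟨ Nx₀≥0 ⟩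
    N zero zero * + x zero + row₀-tail N (x ∘ suc) ≤⟨ ℤP.+-monoʳ-≤ (N zero zero * + x zero) (row₀-tail-nonPos N (x ∘ suc) Z) ⟩
    N zero zero * + x zero + + 0                   ≡⟨ ℤP.+-identityʳ _ ⟩
    N zero zero * + x zero                         ≡⟨ ℤP.*-comm (N zero zero) (+ x zero) ⟩
    + x zero * N zero zero                         ∎)
    where open ℤP.≤-Reasoning

  -- (N x)₀ is then a sum of non-positive terms
  row₀-zero : N zero zero ≡ + 0 → ∀ j → N zero j ≡ + 0
  row₀-zero N₀₀≡0 zero    = N₀₀≡0
  row₀-zero N₀₀≡0 (suc j) = a*m≡0⇒a≡0 (x>0 (suc j))
    (∑-nonPos-≡0 _ (λ j → nonPos*ℕ (x (suc j)) (Z zero (suc j) λ ()))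
      (ℤP.≤-antisym (row₀-tail-nonPos N (x ∘ suc) Z) (ℤP.≤-trans Nx₀≥0 (ℤP.≤-reflexive Nx₀≡tail))) j)
    where
    Nx₀≡tail : (N *ᵥ x) zero ≡ row₀-tail N (x ∘ suc)
    Nx₀≡tail = trans (cong (λ v → v * + x zero + row₀-tail N (x ∘ suc)) N₀₀≡0)
                     (trans (cong (_+ row₀-tail N (x ∘ suc)) (ℤP.*-zeroˡ (+ x zero))) (ℤP.+-identityˡ _))

condense-*ᵥ : (N : Matrix ℤ (suc n)) (y : Fin n → ℕ) (i : Fin n) →
  (condense N *ᵥ y) i ≡ N zero zero * (minor N zero *ᵥ y) i - N (suc i) zero * row₀-tail N y
condense-*ᵥ {n} N y i = begin
  ∑ (λ j → (a * N (suc i) (suc j) - b * N zero (suc j)) * + y j)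
    ≡⟨ ∑-cong (λ j → expand a (N (suc i) (suc j)) b (N zero (suc j)) (+ y j)) ⟩
  ∑ (λ j → a * (N (suc i) (suc j) * + y j) + (- b) * (N zero (suc j) * + y j))
    ≡⟨ ∑-distrib-+ (λ j → a * p j) (λ j → (- b) * q j) ⟩
  ∑ (λ j → a * (N (suc i) (suc j) * + y j)) + ∑ (λ j → (- b) * (N zero (suc j) * + y j))
    ≡⟨ sym (cong₂ _+_ (*-distribˡ-∑ a p) (*-distribˡ-∑ (- b) q)) ⟩
  a * (minor N zero *ᵥ y) i + (- b) * row₀-tail N y
    ≡⟨ cong (_+_ (a * (minor N zero *ᵥ y) i)) (sym (ℤP.neg-distribˡ-* b (row₀-tail N y))) ⟩
  a * (minor N zero *ᵥ y) i - b * row₀-tail N y ∎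
  where
  open ≡-Reasoning
  a = N zero zero
  b = N (suc i) zero
  p q : Fin n → ℤ
  p j = N (suc i) (suc j) * + y j
  q j = N zero (suc j) * + y j
  expand : ∀ (a p b q y : ℤ) → (a * p - b * q) * y ≡ a * (p * y) + (- b) * (q * y)
  expand = solve-∀

condense-*ᵥ-tail : (N : Matrix ℤ (suc n)) (x : Fin (suc n) → ℕ) (i : Fin n) →
  (condense N *ᵥ (x ∘ suc)) i ≡ N zero zero * (N *ᵥ x) (suc i) - N (suc i) zero * (N *ᵥ x) zero
condense-*ᵥ-tail N x i = trans (condense-*ᵥ N (x ∘ suc) i)
  (regroup (N zero zero) (N (suc i) zero) (+ x zero) ((minor N zero *ᵥ (x ∘ suc)) i) (row₀-tail N (x ∘ suc)))
  where
  regroup : ∀ (a b x₀ m r : ℤ) → a * m - b * r ≡ a * (b * x₀ + m) - b * (a * x₀ + r)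
  regroup = solve-∀

minor₀-ZMatrix : (N : Matrix ℤ (suc n)) → ZMatrix N → ZMatrix (minor N zero)
minor₀-ZMatrix N Z i j i≢j = Z (suc i) (suc j) (i≢j ∘ FinP.suc-injective)

condense-ZMatrix : (N : Matrix ℤ (suc n)) → ZMatrix N → + 0 ℤ.≤ N zero zero → ZMatrix (condense N)
condense-ZMatrix N Z 0≤a i j i≢j = ℤP.≤-trans
  (ℤP.+-mono-≤ (nonNeg*nonPos 0≤a (Z (suc i) (suc j) (i≢j ∘ FinP.suc-injective)))
               (ℤP.neg-mono-≤ (nonPos*nonPos (Z (suc i) zero λ ()) (Z zero (suc j) λ ()))))
  (+≤+ z≤n)

condense-*ᵥ-nonNeg : (N : Matrix ℤ (suc n)) (x : Fin (suc n) → ℕ) → ZMatrix N → + 0 ℤ.< N zero zero →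
  (∀ i → + 0 ℤ.≤ (N *ᵥ x) i) → ∀ i → + 0 ℤ.≤ (condense N *ᵥ (x ∘ suc)) i
condense-*ᵥ-nonNeg N x Z 0<a Nx≥0 i = ℤP.≤-trans
  (ℤP.+-mono-≤ (nonNeg*nonNeg (ℤP.<⇒≤ 0<a) (Nx≥0 (suc i)))
               (ℤP.neg-mono-≤ (nonPos*nonNeg (Z (suc i) zero λ ()) (Nx≥0 zero))))
  (ℤP.≤-reflexive (sym (condense-*ᵥ-tail N x i)))

-- Either row 0 vanishes, or condensation on the positive pivot passes the kernel vector down.
det≡0-of-positiveKernel : (N : Matrix ℤ (suc n)) (x : Fin (suc n) → ℕ) → ZMatrix N → AllPositive x →
  (∀ i → (N *ᵥ x) i ≡ + 0) → det N ≡ + 0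
det≡0-of-positiveKernel {zero} N x Z x>0 Nx≡0 =
  trans (det₁ N) (a*m≡0⇒a≡0 (x>0 zero) (trans (sym (ℤP.+-identityʳ _)) (Nx≡0 zero)))
det≡0-of-positiveKernel {suc n} N x Z x>0 Nx≡0 with N zero zero ℤP.≟ + 0
... | yes a≡0 = det-zeroRow₀ N (row₀-zero N x Z x>0 (ℤP.≤-reflexive (sym (Nx≡0 zero))) a≡0)
... | no  a≢0 = *-cancelˡ-≡0 (pos⇒≢0 (^-pos 0<a n)) (trans (sym (det-condense N 0<a)) condensed)
  where
  0<a : + 0 ℤ.< N zero zero
  0<a = ℤP.≤∧≢⇒< (diag₀-nonNeg N x Z x>0 (ℤP.≤-reflexive (sym (Nx≡0 zero)))) (a≢0 ∘ sym)
  kills : ∀ (a b : ℤ) → a * + 0 - b * + 0 ≡ + 0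
  kills = solve-∀
  condensed : det (condense N) ≡ + 0
  condensed = det≡0-of-positiveKernel (condense N) (x ∘ suc) (condense-ZMatrix N Z (ℤP.<⇒≤ 0<a)) (x>0 ∘ suc)
    λ i → trans (condense-*ᵥ-tail N x i)
                (trans (cong₂ (λ u v → N zero zero * u - N (suc i) zero * v) (Nx≡0 (suc i)) (Nx≡0 zero))
                       (kills (N zero zero) (N (suc i) zero)))

Nonempty : Vec Bool n → Set
Nonempty S = ∃[ i ] lookup S i ≡ true

Proper : Vec Bool n → Set
Proper S = ∃[ j ] lookup S j ≡ false

Closed : {A : Set} → A → Matrix A n → Vec Bool n → Set
Closed 0# M S = ∀ i j → lookup S i ≡ true → lookup S j ≡ false → M i j ≡ 0#

ClosedKernelSet : Matrix ℤ n → (Fin n → ℕ) → Vec Bool n → Set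
ClosedKernelSet N x S = Closed (+ 0) N S × (∀ i → lookup S i ≡ true → (N *ᵥ x) i ≡ + 0)

true≢false : true ≢ false
true≢false ()

∈∉⇒≢ : (S : Vec Bool n) {i j : Fin n} → lookup S i ≡ true → lookup S j ≡ false → i ≢ j
∈∉⇒≢ S i∈S j∉S refl = true≢false (trans (sym i∈S) j∉S)

singleton₀ : ∀ n → Vec Bool (suc n)
singleton₀ n = true ∷ replicate n false

singleton₀-suc : (i : Fin n) → lookup (singleton₀ n) (suc i) ≡ false
singleton₀-suc i = VecP.lookup-replicate i false

suc∉singleton₀ : (i : Fin n) → lookup (singleton₀ n) (suc i) ≢ true
suc∉singleton₀ i i∈S = true≢false (trans (sym i∈S) (singleton₀-suc i))

singleton₀-nonempty : Nonempty (singleton₀ n)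
singleton₀-nonempty = zero , refl

singleton₀-proper : Proper (singleton₀ (suc n))
singleton₀-proper {n} = suc zero , singleton₀-suc {n = suc n} zero

zeroRow₀-closedKernelSet : (N : Matrix ℤ (suc n)) (x : Fin (suc n) → ℕ) → (∀ j → N zero j ≡ + 0) →
  ClosedKernelSet N x (singleton₀ n)
zeroRow₀-closedKernelSet {n} N x row≡0 = closed , kernel
  where
  closed : Closed (+ 0) N (singleton₀ n)
  closed zero    j _   _ = row≡0 j
  closed (suc i) j i∈S _ = ⊥-elim (suc∉singleton₀ i i∈S)
  kernel : ∀ i → lookup (singleton₀ n) i ≡ true → (N *ᵥ x) i ≡ + 0
  kernel zero _ = ∑-zero (λ j → N zero j * + x j) λ j → trans (cong (_* + x j) (row≡0 j)) (ℤP.*-zeroˡ (+ x j))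
  kernel (suc i) i∈S = ⊥-elim (suc∉singleton₀ i i∈S)

module _ (N : Matrix ℤ (suc n)) (Z : ZMatrix N) (0<a : + 0 ℤ.< N zero zero) where

  condense-*ᵥ-≡0 : (x : Fin (suc n) → ℕ) → (∀ i → + 0 ℤ.≤ (N *ᵥ x) i) → ∀ i → (condense N *ᵥ (x ∘ suc)) i ≡ + 0 →
    (N *ᵥ x) (suc i) ≡ + 0 × N (suc i) zero * (N *ᵥ x) zero ≡ + 0
  condense-*ᵥ-≡0 x Nx≥0 i ≡0
    with nonNeg-nonPos≡0 (nonNeg*nonNeg (ℤP.<⇒≤ 0<a) (Nx≥0 (suc i))) (nonPos*nonNeg (Z (suc i) zero λ ()) (Nx≥0 zero))
                         (trans (sym (condense-*ᵥ-tail N x i)) ≡0)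
  ... | a*Nxᵢ≡0 , b*Nx₀≡0 = *-cancelˡ-≡0 (pos⇒≢0 0<a) a*Nxᵢ≡0 , b*Nx₀≡0

  condense-≡0 : ∀ i j → i ≢ j → condense N i j ≡ + 0 → N (suc i) (suc j) ≡ + 0 × N (suc i) zero * N zero (suc j) ≡ + 0
  condense-≡0 i j i≢j ≡0
    with nonPos-nonNeg≡0 (nonNeg*nonPos (ℤP.<⇒≤ 0<a) (Z (suc i) (suc j) (i≢j ∘ FinP.suc-injective)))
                         (nonPos*nonPos (Z (suc i) zero λ ()) (Z zero (suc j) λ ())) ≡0
  ... | a*Nᵢⱼ≡0 , bc≡0 = *-cancelˡ-≡0 (pos⇒≢0 0<a) a*Nᵢⱼ≡0 , bc≡0

  -- 0 joins the lifted set exactly when some member of it has a non-zero entry in column 0.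
  closedKernelSet-uncondense : (x : Fin (suc n) → ℕ) → (∀ i → + 0 ℤ.≤ (N *ᵥ x) i) →
    (S : Vec Bool n) → ClosedKernelSet (condense N) (x ∘ suc) S → ∃[ b ] ClosedKernelSet N x (b ∷ S)
  closedKernelSet-uncondense x Nx≥0 S (closed , kernel)
    with FinP.any? (λ i → (lookup S i Bool.≟ true) ×-dec (¬? (N (suc i) zero ℤP.≟ + 0)))
  ... | yes (i₀ , i₀∈S , bᵢ₀≢0) = true , closed′ , kernel′
    where
    Nx₀≡0 : (N *ᵥ x) zero ≡ + 0
    Nx₀≡0 = *-cancelˡ-≡0 bᵢ₀≢0 (proj₂ (condense-*ᵥ-≡0 x Nx≥0 i₀ (kernel i₀ i₀∈S)))
    closed′ : Closed (+ 0) N (true ∷ S)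
    closed′ _       zero    _   ()
    closed′ zero    (suc j) _   j∉S = *-cancelˡ-≡0 bᵢ₀≢0
      (proj₂ (condense-≡0 i₀ j (∈∉⇒≢ S i₀∈S j∉S) (closed i₀ j i₀∈S j∉S)))
    closed′ (suc i) (suc j) i∈S j∉S = proj₁ (condense-≡0 i j (∈∉⇒≢ S i∈S j∉S) (closed i j i∈S j∉S))
    kernel′ : ∀ i → lookup (true ∷ S) i ≡ true → (N *ᵥ x) i ≡ + 0
    kernel′ zero    _   = Nx₀≡0
    kernel′ (suc i) i∈S = proj₁ (condense-*ᵥ-≡0 x Nx≥0 i (kernel i i∈S))
  ... | no ∄i = false , closed′ , kernel′
    where
    column₀ : ∀ i → lookup S i ≡ true → N (suc i) zero ≡ + 0
    column₀ i i∈S = decidable-stable (N (suc i) zero ℤP.≟ + 0) λ bᵢ≢0 → ∄i (i , i∈S , bᵢ≢0)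
    closed′ : Closed (+ 0) N (false ∷ S)
    closed′ zero    _       ()
    closed′ (suc i) zero    i∈S _   = column₀ i i∈S
    closed′ (suc i) (suc j) i∈S j∉S = proj₁ (condense-≡0 i j (∈∉⇒≢ S i∈S j∉S) (closed i j i∈S j∉S))
    kernel′ : ∀ i → lookup (false ∷ S) i ≡ true → (N *ᵥ x) i ≡ + 0
    kernel′ zero    ()
    kernel′ (suc i) i∈S = proj₁ (condense-*ᵥ-≡0 x Nx≥0 i (kernel i i∈S))

-- Both parts come out of the same induction, hence the bundle.
SemipositiveDet : Matrix ℤ (suc n) → (Fin (suc n) → ℕ) → Set
SemipositiveDet {n} N x = + 0 ℤ.≤ det N × (det N ≡ + 0 → ∃[ S ] Nonempty S × ClosedKernelSet N x S)

det-semipositive : (N : Matrix ℤ (suc n)) (x : Fin (suc n) → ℕ) → ZMatrix N → AllPositive x →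
  (∀ i → + 0 ℤ.≤ (N *ᵥ x) i) → SemipositiveDet N x
det-semipositive {zero} N x Z x>0 Nx≥0 =
  ℤP.≤-trans (diag₀-nonNeg N x Z x>0 (Nx≥0 zero)) (ℤP.≤-reflexive (sym (det₁ N))) ,
  λ det≡0 → singleton₀ 0 , singleton₀-nonempty ,
            zeroRow₀-closedKernelSet N x λ { zero → trans (sym (det₁ N)) det≡0 }
det-semipositive {suc n} N x Z x>0 Nx≥0 = byPivot (N zero zero ℤP.≟ + 0)
  where
  byPivot : Dec (N zero zero ≡ + 0) → SemipositiveDet N x
  byPivot (yes a≡0) = ℤP.≤-reflexive (sym (det-zeroRow₀ N row≡0)) ,
                      λ _ → singleton₀ (suc n) , singleton₀-nonempty , zeroRow₀-closedKernelSet N x row≡0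
    where
    row≡0 : ∀ j → N zero j ≡ + 0
    row≡0 = row₀-zero N x Z x>0 (Nx≥0 zero) a≡0
  byPivot (no a≢0) = *-cancelˡ-nonNeg (^-pos 0<a n) (ℤP.≤-trans (proj₁ ih) (ℤP.≤-reflexive (det-condense N 0<a))) , uncondensed
    where
    0<a : + 0 ℤ.< N zero zero
    0<a = ℤP.≤∧≢⇒< (diag₀-nonNeg N x Z x>0 (Nx≥0 zero)) (a≢0 ∘ sym)
    ih : SemipositiveDet (condense N) (x ∘ suc)
    ih = det-semipositive (condense N) (x ∘ suc) (condense-ZMatrix N Z (ℤP.<⇒≤ 0<a)) (x>0 ∘ suc)
                          (condense-*ᵥ-nonNeg N x Z 0<a Nx≥0)
    uncondense : (∃[ S ] Nonempty S × ClosedKernelSet (condense N) (x ∘ suc) S) → ∃[ S ] Nonempty S × ClosedKernelSet N x S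
    uncondense (S , (i , i∈S) , closedKernel) =
      let (b , closedKernel′) = closedKernelSet-uncondense N Z 0<a x Nx≥0 S closedKernel
      in (b ∷ S) , (suc i , i∈S) , closedKernel′
    uncondensed : det N ≡ + 0 → ∃[ S ] Nonempty S × ClosedKernelSet N x S
    uncondensed det≡0 = uncondense (proj₂ ih (det-condense-≡0 N 0<a det≡0))

strictlyIncreasing⇒injective : {m : ℕ} {σ : Fin m → Fin n} → StrictlyIncreasing σ → ∀ {i j} → σ i ≡ σ j → i ≡ j
strictlyIncreasing⇒injective {σ = σ} inc {i} {j} σi≡σj with ℕP.<-cmp (toℕ i) (toℕ j)
... | tri< i<j _ _ = ⊥-elim (ℕP.<-irrefl (cong toℕ σi≡σj) (inc i j i<j))
... | tri≈ _ i≡j _ = FinP.toℕ-injective i≡j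
... | tri> _ _ j<i = ⊥-elim (ℕP.<-irrefl (cong toℕ (sym σi≡σj)) (inc j i j<i))

strictlyIncreasing⇒≤ : {m : ℕ} {σ : Fin m → Fin n} → StrictlyIncreasing σ → m ℕ.≤ n
strictlyIncreasing⇒≤ inc = FinP.injective⇒≤ (strictlyIncreasing⇒injective inc)

strictlyIncreasing-punchOut₀ : {m : ℕ} (σ : Fin m → Fin (suc n)) (σ≢0 : ∀ i → zero ≢ σ i) →
  StrictlyIncreasing σ → StrictlyIncreasing (λ i → punchOut (σ≢0 i))
strictlyIncreasing-punchOut₀ σ σ≢0 inc i j i<j = ℕP.≤-pred (subst₂ ℕ._<_
  (cong toℕ (sym (FinP.punchIn-punchOut (σ≢0 i)))) (cong toℕ (sym (FinP.punchIn-punchOut (σ≢0 j)))) (inc i j i<j))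

strictlyIncreasing-lift : {m : ℕ} (σ : Fin m → Fin n) → StrictlyIncreasing σ → StrictlyIncreasing (lift 1 σ)
strictlyIncreasing-lift σ inc zero    (suc j) _         = s≤s z≤n
strictlyIncreasing-lift σ inc (suc i) (suc j) (s≤s i<j) = s≤s (inc i j i<j)

module _ {m : ℕ} {σ : Fin (suc m) → Fin (suc n)} (inc : StrictlyIncreasing σ) where

  strictlyIncreasing-tail : StrictlyIncreasing (σ ∘ suc)
  strictlyIncreasing-tail i j i<j = inc (suc i) (suc j) (s≤s i<j)

  strictlyIncreasing-suc≢0 : ∀ i → zero ≢ σ (suc i)
  strictlyIncreasing-suc≢0 i 0≡σi = ℕP.n≮0 (subst (λ v → toℕ (σ zero) ℕ.< toℕ v) (sym 0≡σi) (inc zero (suc i) (s≤s z≤n)))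

  strictlyIncreasing-≢0 : σ zero ≢ zero → ∀ i → zero ≢ σ i
  strictlyIncreasing-≢0 σ0≢0 zero    0≡σ0 = σ0≢0 (sym 0≡σ0)
  strictlyIncreasing-≢0 σ0≢0 (suc i)      = strictlyIncreasing-suc≢0 i

-- If σ 0 ≠ 0 then σ would squeeze Fin (suc n) injectively into Fin n.
strictlyIncreasing-id : (σ : Fin n → Fin n) → StrictlyIncreasing σ → ∀ i → σ i ≡ i
strictlyIncreasing-id {suc n} σ inc = pointwise
  where
  σ0≡0 : σ zero ≡ zero
  σ0≡0 = decidable-stable (σ zero FinP.≟ zero) λ σ0≢0 → ℕP.<-irrefl refl
    (strictlyIncreasing⇒≤ (strictlyIncreasing-punchOut₀ σ (strictlyIncreasing-≢0 inc σ0≢0) inc))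
  σ≢0 = strictlyIncreasing-suc≢0 inc
  pointwise : ∀ i → σ i ≡ i
  pointwise zero    = σ0≡0
  pointwise (suc i) = trans (sym (FinP.punchIn-punchOut (σ≢0 i)))
    (cong suc (strictlyIncreasing-id (λ i → punchOut (σ≢0 i))
                 (strictlyIncreasing-punchOut₀ (σ ∘ suc) σ≢0 (strictlyIncreasing-tail inc)) i))

ProperMinorsPositive : Matrix ℤ n → Set
ProperMinorsPositive {n} N =
  ∀ k (σ : Fin k → Fin n) → k ℕ.< n → StrictlyIncreasing σ → + 0 ℤ.< principalMinor N σ

principalMinor-cong : (N : Matrix ℤ n) {σ τ : Fin k → Fin n} → (∀ i → σ i ≡ τ i) → principalMinor N σ ≡ principalMinor N τ
principalMinor-cong N σ≡τ = det-cong λ i j → cong₂ N (σ≡τ i) (σ≡τ j)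

properMinorsPositive⇒pivot-pos : (N : Matrix ℤ (suc (suc n))) → ProperMinorsPositive N → + 0 ℤ.< N zero zero
properMinorsPositive⇒pivot-pos N pos =
  ℤP.<-≤-trans (pos 1 (λ _ → zero) (s≤s (s≤s z≤n)) λ { zero zero () }) (ℤP.≤-reflexive (det₁ (λ _ _ → N zero zero)))

condense-principalMinor : (N : Matrix ℤ (suc n)) → + 0 ℤ.< N zero zero → (σ : Fin (suc k) → Fin n) →
  principalMinor (condense N) σ ≡ N zero zero ^ k * principalMinor N (lift 1 σ)
condense-principalMinor N 0<a σ = det-condense (λ i j → N (lift 1 σ i) (lift 1 σ j)) 0<a

condense-properMinorsPositive : (N : Matrix ℤ (suc (suc n))) → ProperMinorsPositive N → ProperMinorsPositive (condense N)
condense-properMinorsPositive N pos zero    σ _   _   = +<+ (s≤s z≤n)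
condense-properMinorsPositive N pos (suc k) σ k<n inc =
  ℤP.<-≤-trans (pos*pos (^-pos 0<a k) (pos (suc (suc k)) (lift 1 σ) (s≤s k<n) (strictlyIncreasing-lift σ inc)))
               (ℤP.≤-reflexive (sym (condense-principalMinor N 0<a σ)))
  where
  0<a = properMinorsPositive⇒pivot-pos N pos

-- Constructive form: every non-empty proper S has an explicit non-zero entry leaving it.
NoClosedSubset : Matrix ℤ n → Set
NoClosedSubset {n} N = ∀ S → Nonempty S → Proper S →
  ∃[ i ] ∃[ j ] lookup S i ≡ true × lookup S j ≡ false × N i j ≢ + 0

module _ (N : Matrix ℤ (suc n)) (Z : ZMatrix N) (0<a : + 0 ℤ.< N zero zero) where

  condense-neg-direct : ∀ i j → N (suc i) (suc j) ℤ.< + 0 → condense N i j ℤ.< + 0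
  condense-neg-direct i j Nᵢⱼ<0 =
    ℤP.+-mono-<-≤ (pos*neg 0<a Nᵢⱼ<0) (ℤP.neg-mono-≤ (nonPos*nonPos (Z (suc i) zero λ ()) (Z zero (suc j) λ ())))

  condense-neg-via₀ : ∀ i j → i ≢ j → N (suc i) zero ℤ.< + 0 → N zero (suc j) ℤ.< + 0 → condense N i j ℤ.< + 0
  condense-neg-via₀ i j i≢j Nᵢ₀<0 N₀ⱼ<0 =
    ℤP.+-mono-≤-< (nonNeg*nonPos (ℤP.<⇒≤ 0<a) (Z (suc i) (suc j) (i≢j ∘ FinP.suc-injective))) (ℤP.neg-mono-< (neg*neg Nᵢ₀<0 N₀ⱼ<0))

  private
    nonZero⇒neg : ∀ {i j} → i ≢ j → N i j ≢ + 0 → N i j ℤ.< + 0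
    nonZero⇒neg i≢j Nᵢⱼ≢0 = ℤP.≤∧≢⇒< (Z _ _ i≢j) Nᵢⱼ≢0

  -- An edge leaving S in condense N comes either from an edge of N between its images, or from a
  -- path through 0; the two choices of whether 0 belongs to S find the edges of N needed.
  condense-noClosedSubset : NoClosedSubset N → NoClosedSubset (condense N)
  condense-noClosedSubset noClosed S (i₁ , i₁∈S) (j₁ , j₁∉S)
    with noClosed (false ∷ S) (suc i₁ , i₁∈S) (zero , refl)
  ... | suc i , suc j , i∈S , j∉S , Nᵢⱼ≢0 =
    i , j , i∈S , j∉S , ℤP.<⇒≢ (condense-neg-direct i j (nonZero⇒neg (∈∉⇒≢ (false ∷ S) i∈S j∉S) Nᵢⱼ≢0))
  ... | suc i , zero , i∈S , _ , Nᵢ₀≢0 with noClosed (true ∷ S) (zero , refl) (suc j₁ , j₁∉S)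
  ...   | suc i′ , suc j , i′∈S , j∉S , Nᵢ′ⱼ≢0 =
    i′ , j , i′∈S , j∉S , ℤP.<⇒≢ (condense-neg-direct i′ j (nonZero⇒neg (∈∉⇒≢ (true ∷ S) i′∈S j∉S) Nᵢ′ⱼ≢0))
  ...   | zero , suc j , _ , j∉S , N₀ⱼ≢0 =
    i , j , i∈S , j∉S , ℤP.<⇒≢ (condense-neg-via₀ i j (∈∉⇒≢ S i∈S j∉S) (nonZero⇒neg (λ ()) Nᵢ₀≢0) (nonZero⇒neg (λ ()) N₀ⱼ≢0))

-- After condensation, N x ≤ 0 splits into (N x)ᵢ = 0 for i ≥ 1 and Nᵢ₀ (N x)₀ = 0; if the whole
-- column 0 below the pivot vanished, x would be a positive kernel vector of the minor at 0, whose
-- determinant is positive.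
nonPosImage⇒kernel : (N : Matrix ℤ (suc n)) (x : Fin (suc n) → ℕ) → ZMatrix N → AllPositive x →
  ProperMinorsPositive N → + 0 ℤ.≤ det N → (∀ i → (N *ᵥ x) i ℤ.≤ + 0) → ∀ i → (N *ᵥ x) i ≡ + 0
nonPosImage⇒kernel {zero} N x Z x>0 pos 0≤det Nx≤0 zero = ℤP.≤-antisym (Nx≤0 zero)
  (ℤP.≤-trans (nonNeg*nonNeg (ℤP.≤-trans 0≤det (ℤP.≤-reflexive (det₁ N))) (+≤+ z≤n)) (ℤP.≤-reflexive (sym (ℤP.+-identityʳ _))))
nonPosImage⇒kernel {suc n} N x Z x>0 pos 0≤det Nx≤0 = kernel
  where
  0<a = properMinorsPositive⇒pivot-pos N pos
  condensed : ∀ i → (condense N *ᵥ (x ∘ suc)) i ≡ + 0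
  condensed = nonPosImage⇒kernel (condense N) (x ∘ suc) (condense-ZMatrix N Z (ℤP.<⇒≤ 0<a)) (x>0 ∘ suc)
    (condense-properMinorsPositive N pos)
    (ℤP.≤-trans (nonNeg*nonNeg (ℤP.<⇒≤ (^-pos 0<a n)) 0≤det) (ℤP.≤-reflexive (sym (det-condense N 0<a))))
    (λ i → ℤP.≤-trans (ℤP.≤-reflexive (condense-*ᵥ-tail N x i))
             (ℤP.+-mono-≤ (nonNeg*nonPos (ℤP.<⇒≤ 0<a) (Nx≤0 (suc i)))
                          (ℤP.neg-mono-≤ (nonPos*nonPos (Z (suc i) zero λ ()) (Nx≤0 zero)))))
  split : ∀ i → (N *ᵥ x) (suc i) ≡ + 0 × N (suc i) zero * (N *ᵥ x) zero ≡ + 0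
  split i =
    let a*Nxᵢ≡0 , bᵢ*Nx₀≡0 = nonPos-nonNeg≡0 (nonNeg*nonPos (ℤP.<⇒≤ 0<a) (Nx≤0 (suc i)))
                               (nonPos*nonPos (Z (suc i) zero λ ()) (Nx≤0 zero))
                               (trans (sym (condense-*ᵥ-tail N x i)) (condensed i))
    in *-cancelˡ-≡0 (pos⇒≢0 0<a) a*Nxᵢ≡0 , bᵢ*Nx₀≡0
  row₀ : Dec (∃[ i ] N (suc i) zero ≢ + 0) → (N *ᵥ x) zero ≡ + 0
  row₀ (yes (i , bᵢ≢0)) = *-cancelˡ-≡0 bᵢ≢0 (proj₂ (split i))
  row₀ (no ∄i) = ⊥-elim (pos⇒≢0 (pos (suc n) suc ℕP.≤-refl (λ i j → s≤s)) minor₀-singular)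
    where
    column₀ : ∀ i → N (suc i) zero ≡ + 0
    column₀ i = decidable-stable (N (suc i) zero ℤP.≟ + 0) (λ bᵢ≢0 → ∄i (i , bᵢ≢0))
    tail≡ : ∀ i → (N *ᵥ x) (suc i) ≡ (minor N zero *ᵥ (x ∘ suc)) i
    tail≡ i = trans (cong (λ v → v * + x zero + (minor N zero *ᵥ (x ∘ suc)) i) (column₀ i))
                    (trans (cong (_+ (minor N zero *ᵥ (x ∘ suc)) i) (ℤP.*-zeroˡ (+ x zero))) (ℤP.+-identityˡ _))
    minor₀-singular : det (minor N zero) ≡ + 0
    minor₀-singular = det≡0-of-positiveKernel (minor N zero) (x ∘ suc) (minor₀-ZMatrix N Z) (x>0 ∘ suc)
      λ i → trans (sym (tail≡ i)) (proj₁ (split i))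
  kernel : ∀ i → (N *ᵥ x) i ≡ + 0
  kernel zero    = row₀ (FinP.any? (λ i → ¬? (N (suc i) zero ℤP.≟ + 0)))
  kernel (suc i) = proj₁ (split i)

∑-scale : (f : Fin n → ℤ) (c : ℕ) (y : Fin n → ℕ) → ∑ (λ j → f j * + (c ℕ.* y j)) ≡ + c * ∑ (λ j → f j * + y j)
∑-scale f c y = trans (∑-cong λ j → trans (cong (f j *_) (ℤP.pos-* c (y j))) (swap-front (f j) (+ c) (+ y j)))
                      (sym (*-distribˡ-∑ (+ c) (λ j → f j * + y j)))
  where
  swap-front : ∀ (a c y : ℤ) → a * (c * y) ≡ c * (a * y)
  swap-front = solve-∀

ℕ-pos*pos : {m k : ℕ} → 0 ℕ.< m → 0 ℕ.< k → 0 ℕ.< m ℕ.* k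
ℕ-pos*pos {suc m} {suc k} _ _ = s≤s z≤n

row₀-tail-neg : (N : Matrix ℤ (suc (suc n))) → ZMatrix N → NoClosedSubset N →
  (y : Fin (suc n) → ℕ) → AllPositive y → row₀-tail N y ℤ.< + 0
row₀-tail-neg {n} N Z noClosed y y>0 = leaves (noClosed (singleton₀ (suc n)) singleton₀-nonempty singleton₀-proper)
  where
  leaves : (∃[ i ] ∃[ j ] lookup (singleton₀ (suc n)) i ≡ true × lookup (singleton₀ (suc n)) j ≡ false × N i j ≢ + 0) →
    row₀-tail N y ℤ.< + 0
  leaves (suc i , _ , i∈S , _ , _) = ⊥-elim (suc∉singleton₀ i i∈S)
  leaves (zero , suc j , _ , _ , N₀ⱼ≢0) = ∑-nonPos-neg (λ j → N zero (suc j) * + y j)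
    (λ j → nonPos*ℕ (y j) (Z zero (suc j) λ ())) j
    (ℤP.≤-<-trans (ℤP.≤-reflexive (ℤP.*-comm (N zero (suc j)) (+ y j)))
                  (pos*neg (+<+ (y>0 j)) (ℤP.≤∧≢⇒< (Z zero (suc j) λ ()) N₀ⱼ≢0)))

-- A kernel vector y of condense N lifts to (−r , a y) with r = Σⱼ N₀ⱼ yⱼ.
module UncondenseKernel (N : Matrix ℤ (suc (suc n))) (0<a : + 0 ℤ.< N zero zero)
                        (y : Fin (suc n) → ℕ) (y>0 : AllPositive y) (r<0 : row₀-tail N y ℤ.< + 0)
                        (kernel′ : ∀ i → (condense N *ᵥ y) i ≡ + 0) where

  private
    r = row₀-tail N y
    ∣a∣≡a : + ℤ.∣ N zero zero ∣ ≡ N zero zero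
    ∣a∣≡a = ℤP.0≤i⇒+∣i∣≡i (ℤP.<⇒≤ 0<a)
    ∣r∣≡-r : + ℤ.∣ r ∣ ≡ - r
    ∣r∣≡-r = trans (cong +_ (sym (ℤP.∣-i∣≡∣i∣ r))) (ℤP.0≤i⇒+∣i∣≡i (ℤP.neg-mono-≤ (ℤP.<⇒≤ r<0)))

  x : Fin (suc (suc n)) → ℕ
  x zero    = ℤ.∣ r ∣
  x (suc j) = ℤ.∣ N zero zero ∣ ℕ.* y j

  x>0 : AllPositive x
  x>0 zero    = ℤP.drop‿+<+ (subst (+ 0 ℤ.<_) (sym ∣r∣≡-r) (ℤP.neg-mono-< r<0))
  x>0 (suc j) = ℕ-pos*pos (ℤP.drop‿+<+ (subst (+ 0 ℤ.<_) (sym ∣a∣≡a) 0<a)) (y>0 j)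

  private
    tail-scale : ∀ (f : Fin (suc n) → ℤ) → ∑ (λ j → f j * + x (suc j)) ≡ N zero zero * ∑ (λ j → f j * + y j)
    tail-scale f = trans (∑-scale f ℤ.∣ N zero zero ∣ y) (cong (_* ∑ (λ j → f j * + y j)) ∣a∣≡a)

  kernel : ∀ i → (N *ᵥ x) i ≡ + 0
  kernel zero = begin
    N zero zero * + x zero + ∑ (λ j → N zero (suc j) * + x (suc j))
      ≡⟨ cong₂ _+_ (cong (N zero zero *_) ∣r∣≡-r) (tail-scale (λ j → N zero (suc j))) ⟩
    N zero zero * - r + N zero zero * r
      ≡⟨ cancel (N zero zero) r ⟩
    + 0 ∎
    where
    open ≡-Reasoning
    cancel : ∀ (a r : ℤ) → a * - r + a * r ≡ + 0
    cancel = solve-∀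
  kernel (suc i) = begin
    N (suc i) zero * + x zero + ∑ (λ j → N (suc i) (suc j) * + x (suc j))
      ≡⟨ cong₂ _+_ (cong (N (suc i) zero *_) ∣r∣≡-r) (tail-scale (λ j → N (suc i) (suc j))) ⟩
    N (suc i) zero * - r + N zero zero * (minor N zero *ᵥ y) i
      ≡⟨ regroup (N zero zero) (N (suc i) zero) r ((minor N zero *ᵥ y) i) ⟩
    N zero zero * (minor N zero *ᵥ y) i - N (suc i) zero * r
      ≡⟨ sym (condense-*ᵥ N y i) ⟩
    (condense N *ᵥ y) i
      ≡⟨ kernel′ i ⟩
    + 0 ∎
    where
    open ≡-Reasoning
    regroup : ∀ (a b r m : ℤ) → b * - r + a * m ≡ a * m - b * r
    regroup = solve-∀

positiveKernel-exists : (N : Matrix ℤ (suc n)) → ZMatrix N → ProperMinorsPositive N → det N ≡ + 0 → NoClosedSubset N →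
  ∃[ x ] AllPositive x × (∀ i → (N *ᵥ x) i ≡ + 0)
positiveKernel-exists {zero} N Z pos det≡0 noClosed = (λ _ → 1) , (λ _ → s≤s z≤n) ,
  λ { zero → trans (ℤP.+-identityʳ _) (trans (ℤP.*-identityʳ (N zero zero)) (trans (sym (det₁ N)) det≡0)) }
positiveKernel-exists {suc n} N Z pos det≡0 noClosed =
  let 0<a = properMinorsPositive⇒pivot-pos N pos
      y , y>0 , kernel′ = positiveKernel-exists (condense N) (condense-ZMatrix N Z (ℤP.<⇒≤ 0<a))
        (condense-properMinorsPositive N pos)
        (det-condense-≡0 N 0<a det≡0) (condense-noClosedSubset N Z 0<a noClosed)
      open UncondenseKernel N 0<a y y>0 (row₀-tail-neg N Z noClosed y y>0) kernel′
  in x , x>0 , kernel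

-- A principal minor either contains index 0, and is then a minor of condense N up to a power of the
-- pivot, or avoids it, and is then a principal minor of minor N zero.
properMinorsPositive-byPivot : (N : Matrix ℤ (suc (suc n))) → + 0 ℤ.< N zero zero →
  ProperMinorsPositive (condense N) → ProperMinorsPositive (minor N zero) → + 0 ℤ.< det (minor N zero) →
  ProperMinorsPositive N
properMinorsPositive-byPivot {n} N 0<a posCondensed posMinor 0<detMinor = positive
  where
  avoiding0 : ∀ m (σ : Fin (suc m) → Fin (suc (suc n))) → StrictlyIncreasing σ → (σ≢0 : ∀ i → zero ≢ σ i) →
    + 0 ℤ.< principalMinor N σ
  avoiding0 m σ inc σ≢0 = ℤP.<-≤-trans inMinor (ℤP.≤-reflexive (principalMinor-cong N (FinP.punchIn-punchOut ∘ σ≢0)))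
    where
    σ′ : Fin (suc m) → Fin (suc n)
    σ′ i = punchOut (σ≢0 i)
    inc′ : StrictlyIncreasing σ′
    inc′ = strictlyIncreasing-punchOut₀ σ σ≢0 inc
    inMinor : + 0 ℤ.< principalMinor (minor N zero) σ′
    inMinor with ℕP.m≤n⇒m<n∨m≡n (strictlyIncreasing⇒≤ inc′)
    ... | inj₁ m<n  = posMinor (suc m) σ′ m<n inc′
    ... | inj₂ refl = ℤP.<-≤-trans 0<detMinor (ℤP.≤-reflexive (sym (principalMinor-cong (minor N zero) (strictlyIncreasing-id σ′ inc′))))
  through0 : ∀ m (σ : Fin (suc (suc m)) → Fin (suc (suc n))) → suc (suc m) ℕ.< suc (suc n) → StrictlyIncreasing σ →
    σ zero ≡ zero → + 0 ℤ.< principalMinor N σ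
  through0 m σ m<n inc σ0≡0 =
    ℤP.<-≤-trans (*-cancelˡ-pos (ℤP.<⇒≤ (^-pos 0<a m)) inCondensed) (ℤP.≤-reflexive (principalMinor-cong N σ≡lift))
    where
    σ≢0 = strictlyIncreasing-suc≢0 inc
    σ′ : Fin (suc m) → Fin (suc n)
    σ′ i = punchOut (σ≢0 i)
    σ≡lift : ∀ i → lift 1 σ′ i ≡ σ i
    σ≡lift zero    = sym σ0≡0
    σ≡lift (suc i) = FinP.punchIn-punchOut (σ≢0 i)
    inCondensed : + 0 ℤ.< N zero zero ^ m * principalMinor N (lift 1 σ′)
    inCondensed = ℤP.<-≤-trans
      (posCondensed (suc m) σ′ (ℕP.≤-pred m<n) (strictlyIncreasing-punchOut₀ (σ ∘ suc) σ≢0 (strictlyIncreasing-tail inc)))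
      (ℤP.≤-reflexive (condense-principalMinor N 0<a σ′))
  positive : ProperMinorsPositive N
  positive zero          σ _   _   = +<+ (s≤s z≤n)
  positive (suc zero)    σ _   inc with σ zero FinP.≟ zero
  ... | yes σ0≡0 = ℤP.<-≤-trans 0<a (ℤP.≤-reflexive
    (trans (cong₂ N (sym σ0≡0) (sym σ0≡0)) (sym (det₁ (λ i j → N (σ i) (σ j))))))
  ... | no  σ0≢0 = avoiding0 zero σ inc (strictlyIncreasing-≢0 inc σ0≢0)
  positive (suc (suc m)) σ m<n inc with σ zero FinP.≟ zero
  ... | yes σ0≡0 = through0 m σ m<n inc σ0≡0
  ... | no  σ0≢0 = avoiding0 (suc m) σ inc (strictlyIncreasing-≢0 inc σ0≢0)

module _ (N : Matrix ℤ (suc n)) (x : Fin (suc n) → ℕ) (Z : ZMatrix N) (Nx≥0 : ∀ i → + 0 ℤ.≤ (N *ᵥ x) i) where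

  minor₀-*ᵥ-nonNeg : ∀ i → + 0 ℤ.≤ (minor N zero *ᵥ (x ∘ suc)) i
  minor₀-*ᵥ-nonNeg i = ℤP.≤-trans (Nx≥0 (suc i)) (ℤP.≤-trans
    (ℤP.+-monoˡ-≤ ((minor N zero *ᵥ (x ∘ suc)) i) (nonPos*ℕ (x zero) (Z (suc i) zero λ ())))
    (ℤP.≤-reflexive (ℤP.+-identityˡ _)))

  minor₀-closedKernelSet : AllPositive x → (S : Vec Bool n) →
    ClosedKernelSet (minor N zero) (x ∘ suc) S → ClosedKernelSet N x (false ∷ S)
  minor₀-closedKernelSet x>0 S (closed , kernel) = closed′ , kernel′
    where
    -- (N x)ᵢ = Nᵢ₀ x₀ ≥ 0 with Nᵢ₀ ≤ 0 on S
    column₀ : ∀ i → lookup S i ≡ true → N (suc i) zero ≡ + 0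
    column₀ i i∈S = a*m≡0⇒a≡0 (x>0 zero) (ℤP.≤-antisym (nonPos*ℕ (x zero) (Z (suc i) zero λ ()))
      (ℤP.≤-trans (Nx≥0 (suc i)) (ℤP.≤-reflexive (trans (cong (_+_ (N (suc i) zero * + x zero)) (kernel i i∈S)) (ℤP.+-identityʳ _)))))
    closed′ : Closed (+ 0) N (false ∷ S)
    closed′ zero    _       ()
    closed′ (suc i) zero    i∈S _   = column₀ i i∈S
    closed′ (suc i) (suc j) i∈S j∉S = closed i j i∈S j∉S
    kernel′ : ∀ i → lookup (false ∷ S) i ≡ true → (N *ᵥ x) i ≡ + 0
    kernel′ zero    ()
    kernel′ (suc i) i∈S = cong₂ (λ u v → u * + x zero + v) (column₀ i i∈S) (kernel i i∈S)

NoProperClosedKernelSet : Matrix ℤ n → (Fin n → ℕ) → Set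
NoProperClosedKernelSet N x = ∀ S → Nonempty S → ClosedKernelSet N x S → ∀ i → lookup S i ≡ true

semipositive⇒properMinorsPositive : (N : Matrix ℤ (suc n)) (x : Fin (suc n) → ℕ) → ZMatrix N → AllPositive x →
  (∀ i → + 0 ℤ.≤ (N *ᵥ x) i) → NoProperClosedKernelSet N x → ProperMinorsPositive N
semipositive⇒properMinorsPositive {zero} N x Z x>0 Nx≥0 full zero    σ _         _ = +<+ (s≤s z≤n)
semipositive⇒properMinorsPositive {zero} N x Z x>0 Nx≥0 full (suc k) σ (s≤s ()) _
semipositive⇒properMinorsPositive {suc n} N x Z x>0 Nx≥0 full = byPivot (N zero zero ℤP.≟ + 0)
  where
  byPivot : Dec (N zero zero ≡ + 0) → ProperMinorsPositive N
  byPivot (yes a≡0) = ⊥-elim (suc∉singleton₀ {n = suc n} zero (full (singleton₀ (suc n)) singleton₀-nonempty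
    (zeroRow₀-closedKernelSet N x (row₀-zero N x Z x>0 (Nx≥0 zero) a≡0)) (suc zero)))
  byPivot (no a≢0) = properMinorsPositive-byPivot N 0<a posCondensed posMinor 0<detMinor
    where
    0<a : + 0 ℤ.< N zero zero
    0<a = ℤP.≤∧≢⇒< (diag₀-nonNeg N x Z x>0 (Nx≥0 zero)) (a≢0 ∘ sym)
    posCondensed : ProperMinorsPositive (condense N)
    posCondensed = semipositive⇒properMinorsPositive (condense N) (x ∘ suc) (condense-ZMatrix N Z (ℤP.<⇒≤ 0<a)) (x>0 ∘ suc)
      (condense-*ᵥ-nonNeg N x Z 0<a Nx≥0)
      λ S (i , i∈S) closedKernel j →
        let b , closedKernel′ = closedKernelSet-uncondense N Z 0<a x Nx≥0 S closedKernel
        in full (b ∷ S) (suc i , i∈S) closedKernel′ (suc j)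
    Zminor : ZMatrix (minor N zero)
    Zminor = minor₀-ZMatrix N Z
    noClosedKernel : ∀ S → Nonempty S → ¬ ClosedKernelSet (minor N zero) (x ∘ suc) S
    noClosedKernel S (i , i∈S) closedKernel =
      true≢false (sym (full (false ∷ S) (suc i , i∈S) (minor₀-closedKernelSet N x Z Nx≥0 x>0 S closedKernel) zero))
    posMinor : ProperMinorsPositive (minor N zero)
    posMinor = semipositive⇒properMinorsPositive (minor N zero) (x ∘ suc) Zminor (x>0 ∘ suc) (minor₀-*ᵥ-nonNeg N x Z Nx≥0)
      λ S nonempty closedKernel → ⊥-elim (noClosedKernel S nonempty closedKernel)
    0<detMinor : + 0 ℤ.< det (minor N zero)
    0<detMinor =
      let 0≤det , singular⇒closed = det-semipositive (minor N zero) (x ∘ suc) Zminor (x>0 ∘ suc) (minor₀-*ᵥ-nonNeg N x Z Nx≥0)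
      in ℤP.≤∧≢⇒< 0≤det λ 0≡det →
           let S , nonempty , closedKernel = singular⇒closed (sym 0≡det)
           in noClosedKernel S nonempty closedKernel

-- Reducibility

record ComplementFirst (S : Vec Bool n) : Set where
  field
    π     : Permutation′ n
    size  : ℕ
    size≤ : size ℕ.≤ n
    ∈⇒≥   : ∀ q → lookup S (π ⟨$⟩ʳ q) ≡ true  → size ℕ.≤ toℕ q
    ∉⇒<   : ∀ q → lookup S (π ⟨$⟩ʳ q) ≡ false → toℕ q ℕ.< size

punchIn-cases : (p q : Fin (suc n)) → q ≡ p ⊎ ∃[ q′ ] q ≡ punchIn p q′
punchIn-cases p q with p FinP.≟ q
... | yes p≡q = inj₁ (sym p≡q)
... | no  p≢q = inj₂ (punchOut p≢q , sym (FinP.punchIn-punchOut p≢q))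

toℕ-punchIn-< : (p : Fin (suc n)) (q : Fin n) → toℕ q ℕ.< toℕ p → toℕ (punchIn p q) ≡ toℕ q
toℕ-punchIn-< (suc p) zero    _         = refl
toℕ-punchIn-< (suc p) (suc q) (s≤s q<p) = cong suc (toℕ-punchIn-< p q q<p)

toℕ-punchIn-≥ : (p : Fin (suc n)) (q : Fin n) → toℕ p ℕ.≤ toℕ q → toℕ (punchIn p q) ≡ suc (toℕ q)
toℕ-punchIn-≥ zero    q       _         = refl
toℕ-punchIn-≥ (suc p) (suc q) (s≤s p≤q) = cong suc (toℕ-punchIn-≥ p q p≤q)

insert-self : (p : Fin (suc n)) (π : Permutation′ n) → insert p zero π ⟨$⟩ʳ p ≡ zero
insert-self p π with p FinP.≟ p
... | yes _   = refl
... | no  p≢p = ⊥-elim (p≢p refl)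

-- The new element 0 is placed just before the elements of S when it is in S, and first otherwise.
complementFirst : (S : Vec Bool n) → ComplementFirst S
complementFirst [] = record { π = Perm.id ; size = 0 ; size≤ = z≤n ; ∈⇒≥ = λ () ; ∉⇒< = λ () }
complementFirst {suc n} (false ∷ S) = record
  { π = insert zero zero π ; size = suc size ; size≤ = s≤s size≤ ; ∈⇒≥ = ∈⇒≥′ ; ∉⇒< = ∉⇒<′ }
  where
  open ComplementFirst (complementFirst S)
  shift : ∀ q′ → lookup (false ∷ S) (insert zero zero π ⟨$⟩ʳ punchIn zero q′) ≡ lookup S (π ⟨$⟩ʳ q′)
  shift q′ = cong (lookup (false ∷ S)) (insert-punchIn zero zero π q′)
  ∈⇒≥′ : ∀ q → lookup (false ∷ S) (insert zero zero π ⟨$⟩ʳ q) ≡ true → suc size ℕ.≤ toℕ q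
  ∈⇒≥′ q q∈ with punchIn-cases zero q
  ... | inj₁ refl        = ⊥-elim (true≢false (trans (sym q∈) (cong (lookup (false ∷ S)) (insert-self zero π))))
  ... | inj₂ (q′ , refl) = s≤s (∈⇒≥ q′ (trans (sym (shift q′)) q∈))
  ∉⇒<′ : ∀ q → lookup (false ∷ S) (insert zero zero π ⟨$⟩ʳ q) ≡ false → toℕ q ℕ.< suc size
  ∉⇒<′ q q∉ with punchIn-cases zero q
  ... | inj₁ refl        = s≤s z≤n
  ... | inj₂ (q′ , refl) = s≤s (∉⇒< q′ (trans (sym (shift q′)) q∉))
complementFirst {suc n} (true ∷ S) = record
  { π = insert p zero π ; size = size ; size≤ = ℕP.m≤n⇒m≤1+n size≤ ; ∈⇒≥ = ∈⇒≥′ ; ∉⇒< = ∉⇒<′ }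
  where
  open ComplementFirst (complementFirst S)
  p : Fin (suc n)
  p = fromℕ< (s≤s size≤)
  toℕ-p : toℕ p ≡ size
  toℕ-p = FinP.toℕ-fromℕ< (s≤s size≤)
  shift : ∀ q′ → lookup (true ∷ S) (insert p zero π ⟨$⟩ʳ punchIn p q′) ≡ lookup S (π ⟨$⟩ʳ q′)
  shift q′ = cong (lookup (true ∷ S)) (insert-punchIn p zero π q′)
  ∈⇒≥′ : ∀ q → lookup (true ∷ S) (insert p zero π ⟨$⟩ʳ q) ≡ true → size ℕ.≤ toℕ q
  ∈⇒≥′ q q∈ with punchIn-cases p q
  ... | inj₁ refl        = ℕP.≤-reflexive (sym toℕ-p)
  ... | inj₂ (q′ , refl) = ℕP.≤-trans size≤q′ (ℕP.≤-trans (ℕP.n≤1+n _)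
                             (ℕP.≤-reflexive (sym (toℕ-punchIn-≥ p q′ (subst (ℕ._≤ toℕ q′) (sym toℕ-p) size≤q′)))))
    where
    size≤q′ = ∈⇒≥ q′ (trans (sym (shift q′)) q∈)
  ∉⇒<′ : ∀ q → lookup (true ∷ S) (insert p zero π ⟨$⟩ʳ q) ≡ false → toℕ q ℕ.< size
  ∉⇒<′ q q∉ with punchIn-cases p q
  ... | inj₁ refl        = ⊥-elim (true≢false (trans (cong (lookup (true ∷ S)) (sym (insert-self p π))) q∉))
  ... | inj₂ (q′ , refl) = subst (ℕ._< size) (sym (toℕ-punchIn-< p q′ (subst (toℕ q′ ℕ.<_) (sym toℕ-p) q′<size))) q′<size
    where
    q′<size = ∉⇒< q′ (trans (sym (shift q′)) q∉)

closed⇒reducible : (L : Matrix ℕ n) (S : Vec Bool n) → Closed 0 L S → Nonempty S → Proper S → Reducible L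
closed⇒reducible {n} L S closed (i , i∈S) (j , j∉S) = π , size , 0<size , size<n , block
  where
  open ComplementFirst (complementFirst S)
  0<size : 0 ℕ.< size
  0<size = ℕP.≤-<-trans z≤n (∉⇒< (π ⟨$⟩ˡ j) (trans (cong (lookup S) (inverseʳ π)) j∉S))
  size<n : size ℕ.< n
  size<n = ℕP.≤-<-trans (∈⇒≥ (π ⟨$⟩ˡ i) (trans (cong (lookup S) (inverseʳ π)) i∈S)) (FinP.toℕ<n _)
  ≥⇒∈ : ∀ q → size ℕ.≤ toℕ q → lookup S (π ⟨$⟩ʳ q) ≡ true
  ≥⇒∈ q size≤q = decidable-stable (lookup S (π ⟨$⟩ʳ q) Bool.≟ true)
    λ q∉ → ℕP.<-irrefl refl (ℕP.<-≤-trans (∉⇒< q (BoolP.¬-not q∉)) size≤q)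
  <⇒∉ : ∀ q → toℕ q ℕ.< size → lookup S (π ⟨$⟩ʳ q) ≡ false
  <⇒∉ q q<size = decidable-stable (lookup S (π ⟨$⟩ʳ q) Bool.≟ false)
    λ q∈ → ℕP.<-irrefl refl (ℕP.<-≤-trans q<size (∈⇒≥ q (BoolP.¬-not q∈)))
  block : ∀ i j → size ℕ.≤ toℕ i → toℕ j ℕ.< size → L (π ⟨$⟩ʳ i) (π ⟨$⟩ʳ j) ≡ 0
  block i j size≤i j<size = closed _ _ (≥⇒∈ i size≤i) (<⇒∉ j j<size)

-- S consists of the indices placed in the lower block by π.
reducible⇒closed : (L : Matrix ℕ n) → Reducible L → ∃[ S ] Closed 0 L S × Nonempty S × Proper S
reducible⇒closed {n} L (π , k , 0<k , k<n , block) = S , closed , (π ⟨$⟩ʳ qₖ , qₖ∈S) , (π ⟨$⟩ʳ q₀ , q₀∉S)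
  where
  below? : Fin n → Bool
  below? j = does (k ℕ.≤? toℕ (π ⟨$⟩ˡ j))
  S = tabulate below?
  lookup-S : ∀ j → lookup S j ≡ below? j
  lookup-S j = VecP.lookup∘tabulate below? j
  ∈⇒≥ : ∀ j → lookup S j ≡ true → k ℕ.≤ toℕ (π ⟨$⟩ˡ j)
  ∈⇒≥ j j∈S = decidable-stable (k ℕ.≤? _) λ k≰ → true≢false (trans (sym j∈S) (trans (lookup-S j) (dec-false (k ℕ.≤? _) k≰)))
  ∉⇒< : ∀ j → lookup S j ≡ false → toℕ (π ⟨$⟩ˡ j) ℕ.< k
  ∉⇒< j j∉S = ℕP.≰⇒> λ k≤ → true≢false (trans (sym (trans (lookup-S j) (dec-true (k ℕ.≤? _) k≤))) j∉S)
  closed : Closed 0 L S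
  closed i j i∈S j∉S = subst₂ (λ u v → L u v ≡ 0) (inverseʳ π) (inverseʳ π)
    (block (π ⟨$⟩ˡ i) (π ⟨$⟩ˡ j) (∈⇒≥ i i∈S) (∉⇒< j j∉S))
  qₖ q₀ : Fin n
  qₖ = fromℕ< k<n
  q₀ = fromℕ< (ℕP.<-trans 0<k k<n)
  qₖ∈S : lookup S (π ⟨$⟩ʳ qₖ) ≡ true
  qₖ∈S = trans (lookup-S _) (dec-true (k ℕ.≤? _)
    (ℕP.≤-reflexive (sym (trans (cong toℕ (inverseˡ π)) (FinP.toℕ-fromℕ< k<n)))))
  q₀∉S : lookup S (π ⟨$⟩ʳ q₀) ≡ false
  q₀∉S = trans (lookup-S _) (dec-false (k ℕ.≤? _)
    (ℕP.<⇒≱ 0<k ∘ subst (k ℕ.≤_) (trans (cong toℕ (inverseˡ π)) (FinP.toℕ-fromℕ< (ℕP.<-trans 0<k k<n)))))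

-- Arithmetical structures

DiagMinus-offDiagonal : (d : Vec ℕ n) (L : Matrix ℕ n) → ∀ i j → i ≢ j → DiagMinus d L i j ≡ - (+ L i j)
DiagMinus-offDiagonal d L i j i≢j with i FinP.≟ j
... | yes i≡j = ⊥-elim (i≢j i≡j)
... | no  _   = refl

DiagMinus-ZMatrix : (d : Vec ℕ n) (L : Matrix ℕ n) → ZMatrix (DiagMinus d L)
DiagMinus-ZMatrix d L i j i≢j = ℤP.≤-trans (ℤP.≤-reflexive (DiagMinus-offDiagonal d L i j i≢j)) (ℤP.neg-mono-≤ (+≤+ z≤n))

mulVec-DiagMinus : (d : Vec ℕ n) (L : Matrix ℕ n) (r : Vec ℕ n) → ∀ i →
  mulVec (DiagMinus d L) r i ≡ + lookup d i * + lookup r i - ∑ (λ j → + L i j * + lookup r j)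
mulVec-DiagMinus {n} d L r i = begin
  ∑ (λ j → DiagMinus d L i j * + lookup r j)
    ≡⟨ ∑-cong split ⟩
  ∑ (λ j → diagonal j + - Lr j)
    ≡⟨ ∑-distrib-+ diagonal (λ j → - Lr j) ⟩
  ∑ diagonal + ∑ (λ j → - Lr j)
    ≡⟨ cong₂ _+_ (trans (∑-single diagonal i offDiagonal) diagonal-i) (sym (neg-distrib-∑ Lr)) ⟩
  + lookup d i * + lookup r i - ∑ Lr ∎
  where
  open ≡-Reasoning
  Lr : Fin n → ℤ
  Lr j = + L i j * + lookup r j
  diagonal : Fin n → ℤ
  diagonal j with i FinP.≟ j
  ... | yes _ = + lookup d i * + lookup r j
  ... | no  _ = + 0
  split : ∀ j → DiagMinus d L i j * + lookup r j ≡ diagonal j + - (+ L i j * + lookup r j)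
  split j with i FinP.≟ j
  ... | yes _ = distrib (+ lookup d i) (+ L i j) (+ lookup r j)
    where
    distrib : ∀ (a b c : ℤ) → (a - b) * c ≡ a * c + - (b * c)
    distrib = solve-∀
  ... | no  _ = distrib (+ L i j) (+ lookup r j)
    where
    distrib : ∀ (b c : ℤ) → (- b) * c ≡ + 0 + - (b * c)
    distrib = solve-∀
  offDiagonal : ∀ j → j ≢ i → diagonal j ≡ + 0
  offDiagonal j j≢i with i FinP.≟ j
  ... | yes i≡j = ⊥-elim (j≢i (sym i≡j))
  ... | no  _   = refl
  diagonal-i : diagonal i ≡ + lookup d i * + lookup r i
  diagonal-i with i FinP.≟ i
  ... | yes _   = refl
  ... | no  i≢i = ⊥-elim (i≢i refl)

irreducible⇒noClosedSubset : (d : Vec ℕ n) (L : Matrix ℕ n) → Irreducible L → NoClosedSubset (DiagMinus d L)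
irreducible⇒noClosedSubset {n} d L irreducible S nonempty proper with FinP.any? (λ i → FinP.any? λ j →
  (lookup S i Bool.≟ true) ×-dec (lookup S j Bool.≟ false) ×-dec ¬? (L i j ℕ.≟ 0))
... | yes (i , j , i∈S , j∉S , Lᵢⱼ≢0) =
  i , j , i∈S , j∉S , λ Mᵢⱼ≡0 → Lᵢⱼ≢0 (ℤP.+-injective (ℤP.neg-injective
    (trans (sym (DiagMinus-offDiagonal d L i j (∈∉⇒≢ S i∈S j∉S))) Mᵢⱼ≡0)))
... | no ∄edge = ⊥-elim (irreducible (closed⇒reducible L S closed nonempty proper))
  where
  closed : Closed 0 L S
  closed i j i∈S j∉S = decidable-stable (L i j ℕ.≟ 0) λ Lᵢⱼ≢0 → ∄edge (i , j , i∈S , j∉S , Lᵢⱼ≢0)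

noClosedSubset⇒noProperClosedKernelSet : (N : Matrix ℤ n) (x : Fin n → ℕ) → NoClosedSubset N → NoProperClosedKernelSet N x
noClosedSubset⇒noProperClosedKernelSet N x noClosed S nonempty (closed , _) i =
  decidable-stable (lookup S i Bool.≟ true) λ i∉S →
    let (j , k , j∈S , k∉S , Nⱼₖ≢0) = noClosed S nonempty (i , BoolP.¬-not i∉S)
    in Nⱼₖ≢0 (closed j k j∈S k∉S)

gcdVec∣lookup : (v : Vec ℕ n) (i : Fin n) → gcdVec v ∣ lookup v i
gcdVec∣lookup (x ∷ xs) zero    = gcd[m,n]∣m x (gcdVec xs)
gcdVec∣lookup (x ∷ xs) (suc i) = ∣-trans (gcd[m,n]∣n x (gcdVec xs)) (gcdVec∣lookup xs i)

gcdVec-greatest : (v : Vec ℕ n) {c : ℕ} → (∀ i → c ∣ lookup v i) → c ∣ gcdVec v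
gcdVec-greatest []       c∣ = _ ∣0
gcdVec-greatest (x ∷ xs) c∣ = gcd-greatest (c∣ zero) (gcdVec-greatest xs (c∣ ∘ suc))

-- Divide by the gcd of the entries; the index only witnesses n ≥ 1, which keeps the gcd non-zero.
primitiveKernel : (M : Matrix ℤ n) (x : Fin n → ℕ) → AllPositive x → (∀ i → (M *ᵥ x) i ≡ + 0) → Fin n →
  ∃[ r ] Positive r × (∀ i → mulVec M r i ≡ + 0) × gcdVec r ≡ 1
primitiveKernel {n} M x x>0 Mx≡0 i₀ = r , r>0 , kernel , gcd≡1
  where
  v = tabulate x
  g = gcdVec v
  q : Fin n → ℕ
  q i = _∣_.quotient (gcdVec∣lookup v i)
  x≡q*g : ∀ i → x i ≡ q i ℕ.* g
  x≡q*g i = trans (sym (VecP.lookup∘tabulate x i)) (_∣_.equality (gcdVec∣lookup v i))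
  g≢0 : g ≢ 0
  g≢0 g≡0 = ℕP.<-irrefl (sym (trans (x≡q*g i₀) (trans (cong (q i₀ ℕ.*_) g≡0) (ℕP.*-zeroʳ (q i₀))))) (x>0 i₀)
  r = tabulate q
  lookup-r : ∀ i → lookup r i ≡ q i
  lookup-r = VecP.lookup∘tabulate q
  r>0 : Positive r
  r>0 i = subst (0 ℕ.<_) (sym (lookup-r i)) (ℕP.n≢0⇒n>0 λ qᵢ≡0 →
    ℕP.<-irrefl (sym (trans (x≡q*g i) (cong (ℕ._* g) qᵢ≡0))) (x>0 i))
  kernel : ∀ i → mulVec M r i ≡ + 0
  kernel i = *-cancelˡ-≡0 (pos⇒≢0 (+<+ (ℕP.n≢0⇒n>0 g≢0))) (begin
    + g * mulVec M r i               ≡⟨ cong (+ g *_) (∑-cong λ j → cong (λ u → M i j * + u) (lookup-r j)) ⟩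
    + g * (M *ᵥ q) i                 ≡⟨ sym (∑-scale (M i) g q) ⟩
    (M *ᵥ (λ j → g ℕ.* q j)) i       ≡⟨ ∑-cong (λ j → cong (λ u → M i j * + u) (sym (trans (x≡q*g j) (ℕP.*-comm (q j) g)))) ⟩
    (M *ᵥ x) i                       ≡⟨ Mx≡0 i ⟩
    + 0                              ∎)
    where open ≡-Reasoning
  gcd≡1 : gcdVec r ≡ 1
  gcd≡1 = ∣1⇒≡1 (*-cancelʳ-∣ g {{ℕ.≢-nonZero g≢0}} (subst (gcdVec r ℕ.* g ∣_) (sym (ℕP.*-identityˡ g))
    (gcdVec-greatest v λ i → subst (gcdVec r ℕ.* g ∣_) (trans (sym (x≡q*g i)) (sym (VecP.lookup∘tabulate x i)))
      (*-monoˡ-∣ g (subst (gcdVec r ∣_) (lookup-r i) (gcdVec∣lookup r i))))))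

module _ (L : Matrix ℕ (suc n)) (irreducible : Irreducible L) (d : Vec ℕ (suc n)) where

  private
    M = DiagMinus d L

  arithmetical⇒singular : DSet L d → det M ≡ + 0
  arithmetical⇒singular (r , _ , r>0 , Mr≡0 , _) = det≡0-of-positiveKernel M (lookup r) (DiagMinus-ZMatrix d L) r>0 Mr≡0

  arithmetical⇒almostNonSingularM : DSet L d → AlmostNonSingularM M
  arithmetical⇒almostNonSingularM D@(r , _ , r>0 , Mr≡0 , _) =
    DiagMinus-ZMatrix d L ,
    semipositive⇒properMinorsPositive M (lookup r) (DiagMinus-ZMatrix d L) r>0 (ℤP.≤-reflexive ∘ sym ∘ Mr≡0)
      (noClosedSubset⇒noProperClosedKernelSet M (lookup r) (irreducible⇒noClosedSubset d L irreducible)) ,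
    ℤP.≤-reflexive (sym (arithmetical⇒singular D))

  -- For d′ ≤ d in D≥0(L), (Diag(d′) − L) r = (d′ − d) ∘ r ≤ 0, which the positivity of the proper
  -- minors forces to vanish.
  arithmetical⇒minimal : DSet L d → ∀ d′ → DGe0 L d′ → d′ ≤ᵥ d → d′ ≡ d
  arithmetical⇒minimal (r , _ , r>0 , Mr≡0 , _) d′ (_ , Z′ , pos′ , 0≤det′) d′≤d =
    trans (sym (VecP.tabulate∘lookup d′)) (trans (VecP.tabulate-cong d′ᵢ≡dᵢ) (VecP.tabulate∘lookup d))
    where
    M′ = DiagMinus d′ L
    Σᵢ : Fin (suc n) → ℤ
    Σᵢ i = ∑ (λ j → + L i j * + lookup r j)
    shift : ∀ (a b c s : ℤ) → a * c - s ≡ (a - b) * c + (b * c - s)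
    shift = solve-∀
    M′r≡ : ∀ i → mulVec M′ r i ≡ (+ lookup d′ i - + lookup d i) * + lookup r i
    M′r≡ i = begin
      mulVec M′ r i
        ≡⟨ mulVec-DiagMinus d′ L r i ⟩
      + lookup d′ i * + lookup r i - Σᵢ i
        ≡⟨ shift (+ lookup d′ i) (+ lookup d i) (+ lookup r i) (Σᵢ i) ⟩
      (+ lookup d′ i - + lookup d i) * + lookup r i + (+ lookup d i * + lookup r i - Σᵢ i)
        ≡⟨ cong (_+_ ((+ lookup d′ i - + lookup d i) * + lookup r i)) (trans (sym (mulVec-DiagMinus d L r i)) (Mr≡0 i)) ⟩
      (+ lookup d′ i - + lookup d i) * + lookup r i + + 0
        ≡⟨ ℤP.+-identityʳ _ ⟩
      (+ lookup d′ i - + lookup d i) * + lookup r i ∎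
      where open ≡-Reasoning
    M′r≡0 : ∀ i → mulVec M′ r i ≡ + 0
    M′r≡0 = nonPosImage⇒kernel M′ (lookup r) Z′ r>0 pos′ 0≤det′ λ i →
      ℤP.≤-trans (ℤP.≤-reflexive (M′r≡ i)) (nonPos*nonNeg (ℤP.i≤j⇒i-j≤0 (+≤+ (d′≤d i))) (+≤+ z≤n))
    d′ᵢ≡dᵢ : ∀ i → lookup d′ i ≡ lookup d i
    d′ᵢ≡dᵢ i = ℤP.+-injective (ℤP.i-j≡0⇒i≡j _ _ (a*m≡0⇒a≡0 (r>0 i) (trans (sym (M′r≡ i)) (M′r≡0 i))))

  minimalSingular⇒arithmetical : Minimal (DGe0 L) d × det M ≡ + 0 → DSet L d
  minimalSingular⇒arithmetical (((d>0 , Z , pos , _) , _) , det≡0) =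
    let x , x>0 , Mx≡0 = positiveKernel-exists M Z pos det≡0 (irreducible⇒noClosedSubset d L irreducible)
        r , r>0 , Mr≡0 , gcd≡1 = primitiveKernel M x x>0 Mx≡0 zero
    in r , d>0 , r>0 , Mr≡0 , gcd≡1

irreducible-arithmeticalStructures : (L : Matrix ℕ n) → Irreducible L →
  ∀ d → DSet L d ⇔ (Minimal (DGe0 L) d × det (DiagMinus d L) ≡ + 0)
irreducible-arithmeticalStructures {zero}  L _ d = mk⇔ (λ { ([] , _ , _ , _ , ()) }) (λ { (_ , ()) })
irreducible-arithmeticalStructures {suc n} L irreducible d = mk⇔
  (λ D → ((proj₁ (proj₂ D) , arithmetical⇒almostNonSingularM L irreducible d D) , arithmetical⇒minimal L irreducible d D) ,
         arithmetical⇒singular L irreducible d D)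
  (minimalSingular⇒arithmetical L irreducible d)

∑-pos : (f : Fin n → ℕ) → ∑ (λ j → + f j) ≡ + sum f
∑-pos {zero}  f = refl
∑-pos {suc n} f = cong (_+_ (+ f zero)) (∑-pos (f ∘ suc))

mulVec-DiagMinus-≡0 : (d : Vec ℕ n) (L : Matrix ℕ n) (r : Vec ℕ n) → ∀ i →
  lookup d i ℕ.* lookup r i ≡ sum (λ j → L i j ℕ.* lookup r j) → mulVec (DiagMinus d L) r i ≡ + 0
mulVec-DiagMinus-≡0 d L r i balanced = begin
  mulVec (DiagMinus d L) r i
    ≡⟨ mulVec-DiagMinus d L r i ⟩
  + lookup d i * + lookup r i - ∑ (λ j → + L i j * + lookup r j)
    ≡⟨ cong₂ _-_ (trans (sym (ℤP.pos-* (lookup d i) (lookup r i))) (cong +_ balanced))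
                 (trans (∑-cong λ j → sym (ℤP.pos-* (L i j) (lookup r j))) (∑-pos (λ j → L i j ℕ.* lookup r j))) ⟩
  + s - + s
    ≡⟨ ℤP.+-inverseʳ (+ s) ⟩
  + 0 ∎
  where
  open ≡-Reasoning
  s = sum (λ j → L i j ℕ.* lookup r j)

zeroRow⇒noArithmeticalStructure : (L : Matrix ℕ n) → HasZeroRow L → ∀ p → ¬ ArithStruct L p
zeroRow⇒noArithmeticalStructure L (i , row≡0) (d , r) (d>0 , r>0 , Mr≡0 , _) =
  ℕP.<-irrefl (sym (ℤP.+-injective (*-cancelˡ-≡0 (pos⇒≢0 (+<+ (d>0 i))) dᵢrᵢ≡0))) (r>0 i)
  where
  dᵢrᵢ≡0 : + lookup d i * + lookup r i ≡ + 0
  dᵢrᵢ≡0 = begin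
    + lookup d i * + lookup r i
      ≡⟨ sym (ℤP.+-identityʳ _) ⟩
    + lookup d i * + lookup r i - + 0
      ≡⟨ cong (_-_ (+ lookup d i * + lookup r i)) (sym (∑-zero _ λ j →
           trans (cong (λ u → + u * + lookup r j) (row≡0 j)) (ℤP.*-zeroˡ (+ lookup r j)))) ⟩
    + lookup d i * + lookup r i - ∑ (λ j → + L i j * + lookup r j)
      ≡⟨ sym (mulVec-DiagMinus d L r i) ⟩
    mulVec (DiagMinus d L) r i
      ≡⟨ Mr≡0 i ⟩
    + 0 ∎
    where open ≡-Reasoning

≤-sum : (f : Fin n → ℕ) (i : Fin n) → f i ℕ.≤ sum f
≤-sum f zero    = ℕP.m≤m+n _ _
≤-sum f (suc i) = ℕP.≤-trans (≤-sum (f ∘ suc) i) (ℕP.m≤n+m _ _)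

noZeroRow⇒positiveEntry : (L : Matrix ℕ n) → ¬ HasZeroRow L → ∀ i → ∃[ j ] 0 ℕ.< L i j
noZeroRow⇒positiveEntry L noZeroRow i with FinP.any? (λ j → ¬? (L i j ℕ.≟ 0))
... | yes (j , Lᵢⱼ≢0) = j , ℕP.n≢0⇒n>0 Lᵢⱼ≢0
... | no  ∄j = ⊥-elim (noZeroRow (i , λ j → decidable-stable (L i j ℕ.≟ 0) λ Lᵢⱼ≢0 → ∄j (j , Lᵢⱼ≢0)))

-- With S closed and r = t on S, 1 off S, every row of L r is divisible by the entry of r
-- (rows in S only see columns in S), so d = (L r) / r gives a structure for every t > 0.
module ClosedFamily (L : Matrix ℕ n) (S : Vec Bool n) (closed : Closed 0 L S) (proper : Proper S)
                    (positiveEntry : ∀ i → ∃[ j ] 0 ℕ.< L i j) where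

  weight : ℕ → Bool → ℕ
  weight t true  = t
  weight t false = 1

  r : ℕ → Fin n → ℕ
  r t j = weight t (lookup S j)

  diagonal : ℕ → Fin n → Bool → ℕ
  diagonal t i true  = sum (L i)
  diagonal t i false = sum (λ j → L i j ℕ.* r t j)

  d : ℕ → Fin n → ℕ
  d t i = diagonal t i (lookup S i)

  r>0 : ∀ {t} → 0 ℕ.< t → ∀ j → 0 ℕ.< r t j
  r>0 {t} 0<t j with lookup S j
  ... | true  = 0<t
  ... | false = s≤s z≤n

  d>0 : ∀ {t} → 0 ℕ.< t → ∀ i → 0 ℕ.< d t i
  d>0 {t} 0<t i with lookup S i | positiveEntry i
  ... | true  | j , 0<Lᵢⱼ = ℕP.<-≤-trans 0<Lᵢⱼ (≤-sum (L i) j)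
  ... | false | j , 0<Lᵢⱼ = ℕP.<-≤-trans (ℕP.<-≤-trans 0<Lᵢⱼ (ℕP.m≤m*n (L i j) (r t j) {{ℕ.>-nonZero (r>0 0<t j)}}))
                                        (≤-sum (λ j → L i j ℕ.* r t j) j)

  balanced : ∀ t i → d t i ℕ.* r t i ≡ sum (λ j → L i j ℕ.* r t j)
  balanced t i with lookup S i in i∈S
  ... | false = ℕP.*-identityʳ _
  ... | true  = trans (*-distribʳ-sum t (L i)) (sum-cong-≗ sameWeight)
    where
    sameWeight : ∀ j → L i j ℕ.* t ≡ L i j ℕ.* r t j
    sameWeight j with lookup S j in j∉S
    ... | true  = refl
    ... | false = trans (cong (ℕ._* t) Lᵢⱼ≡0) (sym (cong (ℕ._* 1) Lᵢⱼ≡0))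
      where
      Lᵢⱼ≡0 = closed i j i∈S j∉S

  structure : ∀ t → 0 ℕ.< t → ArithStruct L (tabulate (d t) , tabulate (r t))
  structure t 0<t = d′>0 , r′>0 , balanced′ , gcd≡1
    where
    lookup-d = VecP.lookup∘tabulate (d t)
    lookup-r = VecP.lookup∘tabulate (r t)
    d′>0 : Positive (tabulate (d t))
    d′>0 i = subst (0 ℕ.<_) (sym (lookup-d i)) (d>0 0<t i)
    r′>0 : Positive (tabulate (r t))
    r′>0 j = subst (0 ℕ.<_) (sym (lookup-r j)) (r>0 0<t j)
    balanced′ : ∀ i → mulVec (DiagMinus (tabulate (d t)) L) (tabulate (r t)) i ≡ + 0
    balanced′ i = mulVec-DiagMinus-≡0 (tabulate (d t)) L (tabulate (r t)) i
      (trans (cong₂ ℕ._*_ (lookup-d i) (lookup-r i))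
             (trans (balanced t i) (sum-cong-≗ λ j → cong (L i j ℕ.*_) (sym (lookup-r j)))))
    gcd≡1 : gcdVec (tabulate (r t)) ≡ 1
    gcd≡1 = let j , j∉S = proper in
      ∣1⇒≡1 (subst (gcdVec (tabulate (r t)) ∣_) (trans (lookup-r j) (cong (weight t) j∉S)) (gcdVec∣lookup (tabulate (r t)) j))

  infinite : Nonempty S → Infinite (ArithStruct L)
  infinite (s , s∈S) ps = (tabulate (d t) , tabulate (r t)) , structure t (s≤s z≤n) , fresh
    where
    bound : List (Vec ℕ n × Vec ℕ n) → ℕ
    bound []       = 0
    bound (p ∷ ps) = lookup (proj₂ p) s ℕ.+ bound ps
    ≤bound : ∀ {p ps} → p ∈ ps → lookup (proj₂ p) s ℕ.≤ bound ps
    ≤bound (here refl) = ℕP.m≤m+n _ _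
    ≤bound (there p∈)  = ℕP.≤-trans (≤bound p∈) (ℕP.m≤n+m _ _)
    t = suc (bound ps)
    fresh : (tabulate (d t) , tabulate (r t)) ∉ ps
    fresh p∈ = ℕP.<-irrefl refl (begin-strict
      t                            ≡⟨ cong (weight t) (sym s∈S) ⟩
      r t s                        ≡⟨ VecP.lookup∘tabulate (r t) s ⟨
      lookup (tabulate (r t)) s    ≤⟨ ≤bound p∈ ⟩
      bound ps                     <⟨ ℕP.n<1+n (bound ps) ⟩
      t                            ∎)
      where open ℕP.≤-Reasoning

closedSubset? : (L : Matrix ℕ n) → Dec (∃[ S ] Closed 0 L S × Nonempty S × Proper S)
closedSubset? L = anySubset? λ S →
  FinP.all? (λ i → FinP.all? λ j → (lookup S i Bool.≟ true) →-dec (lookup S j Bool.≟ false) →-dec (L i j ℕ.≟ 0))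
  ×-dec FinP.any? (λ i → lookup S i Bool.≟ true) ×-dec FinP.any? (λ j → lookup S j Bool.≟ false)

-- ¬ Irreducible L only says ¬ ¬ Reducible L; deciding whether a closed subset exists recovers one.
reducible⇒infinite : (L : Matrix ℕ n) → ¬ Irreducible L → ¬ HasZeroRow L → Infinite (ArithStruct L)
reducible⇒infinite L notIrreducible noZeroRow with closedSubset? L
... | yes (S , closed , nonempty , proper) =
  ClosedFamily.infinite L S closed proper (noZeroRow⇒positiveEntry L noZeroRow) nonempty
... | no ∄S = ⊥-elim (notIrreducible λ red → ∄S (reducible⇒closed L red))

corollary3p6 : (n : ℕ) (L : Matrix ℕ n) → ZeroDiag L →
    (Irreducible L →
      ∀ (d : Vec ℕ n) → DSet L d ⇔ (Minimal (DGe0 L) d × det (DiagMinus d L) ≡ + 0))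
    × (¬ Irreducible L → HasZeroRow L → ∀ p → ¬ ArithStruct L p)
    × (¬ Irreducible L → ¬ HasZeroRow L → Infinite (ArithStruct L))
corollary3p6 n L _ =
  irreducible-arithmeticalStructures L ,
  (λ _ → zeroRow⇒noArithmeticalStructure L) ,
  reducible⇒infinite L
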